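{- Let $p,q\ge1$, let $\bm\omega=\omega_1\cdots\omega_{p+q}$ be a word on $\Omega$, and let $\varphi:\{1,\ldots,p+q\}\to\{1,\ldots,s\}$ be a weak $(p,q)$-quasi-shuffle, written uniquely as $\varphi=\delta\circ\sigma$ with $\sigma:\{1,\ldots,p+q\}\to\{1,\ldots,t\}$ a nondecreasing surjection ($t\ge2$) satisfying $\sigma_p<\sigma_{p+1}$ and $\delta:\{1,\ldots,t\}\to\{1,\ldots,s\}$ a $(\sigma_p,t-\sigma_p)$-quasi-shuffle. Then $\sum_{\eta\in\mathrm{qsh}_\varphi(p,q)}(\bm\omega^\eta)^1_{\sigma[\eta]}⧢\cdots⧢(\bm\omega^\eta)^s_{\sigma[\eta]}=\bm\omega^1_\sigma⧢\cdots⧢\bm\omega^t_\sigma$.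
   Context: $\Omega$ is a set with a commutative semigroup law written additively, $[a+b]$ denoting internal sums; words on $\Omega$ span a vector space over a field on which the quasi-shuffle product $⧢$ is defined by $\bm\omega⧢\mathbb 1=\mathbb 1⧢\bm\omega=\bm\omega$ ($\mathbb 1$ the empty word) and $a\bm\omega'⧢b\bm\omega''=a(\bm\omega'⧢b\bm\omega'')+b(a\bm\omega'⧢\bm\omega'')+[a+b](\bm\omega'⧢\bm\omega'')$ for letters $a,b$. For $a,b\ge1$, an $(a,b)$-quasi-shuffle is a surjection $\eta:\{1,\ldots,a+b\}\to\{1,\ldots,m\}$ (some $m$) with $\eta_1<\cdots<\eta_a$ and $\eta_{a+1}<\cdots<\eta_{a+b}$; $\mathrm{qsh}(a,b)$ is the set of these. A weak $(p,q)$-quasi-shuffle is a surjection $\varphi$ onto some $\{1,\ldots,s\}$ with $\varphi_1\le\cdots\le\varphi_p$ and $\varphi_{p+1}\le\cdots\le\varphi_{p+q}$. $\mathrm{qsh}_\varphi(p,q)$ is the set of $\eta\in\mathrm{qsh}(p,q)$ such that $\varphi(a)<\varphi(b)\Rightarrow\eta(a)<\eta(b)$ and $\varphi$ factors through $\eta$; for such $\eta$ with codomain $\{1,\ldots,t'\}$, $\sigma[\eta]:\{1,\ldots,t'\}\to\{1,\ldots,s\}$ is the unique nondecreasing surjection with $\varphi=\sigma[\eta]\circ\eta$. For a word $\bm\omega=\omega_1\cdots\omega_n$ and a surjection $\sigma:\{1,\ldots,n\}\to\{1,\ldots,m\}$: $\bm\omega^\sigma$ is the word $\omega^\sigma_1\cdots\omega^\sigma_m$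 with $\omega^\sigma_k=[\sum_{\sigma_j=k}\omega_j]$, and $\bm\omega^k_\sigma=\omega_{j_1}\cdots\omega_{j_r}$ where $j_1<\cdots<j_r$ are the $\sigma$-preimages of $k$. -}

module Defs where

open import Level using (Level; _⊔_; suc)
open import Data.Nat as ℕ using (ℕ; _∸_)
open import Data.Fin using (Fin; toℕ; _≟_) renaming (_<_ to _<ᶠ_; _≤_ to _≤ᶠ_)
open import Data.Vec using (Vec; lookup; tabulate)
open import Data.List using (List; []; _∷_; map; _++_; foldr; concatMap; filter; allFin; catMaybes)
open import Data.Maybe using (Maybe; just; nothing)
open import Data.Product using (Σ; ∃; _×_; _,_; proj₁; proj₂)
open import Relation.Binary.PropositionalEquality using (_≡_)
open import Relation.Nullary using (¬_)
open import Algebra.Bundles using (CommutativeRing)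
open import Algebra.Structures using (IsCommutativeSemigroup)
open import Data.List.Membership.Propositional using (_∈_)
open import Data.List.Relation.Unary.Unique.Propositional using (Unique)
open import Data.List.Relation.Unary.All using (All)

record Field (c ℓ : Level) : Set (suc (c ⊔ ℓ)) where
  field
    commutativeRing : CommutativeRing c ℓ
  open CommutativeRing commutativeRing public
  field
    0≉1     : ¬ (0# ≈ 1#)
    inverse : ∀ x → ¬ (x ≈ 0#) → Σ Carrier λ y → (x * y) ≈ 1#

-- Every quasi-shuffle product of words (and
-- every sum appearing in the lemma) is a linear combination of words
-- with coefficients 1; we represent such a formal sum as a list of
-- words (repetitions = multiplicities), and interpret it in the
-- K-vector space spanned by words (see `_≈V_` below).

Word : ∀ {a} → Set a → Set a
Word Ω = List Ω

FormalSum : ∀ {a} → Set a → Set a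
FormalSum Ω = List (Word Ω)

module QuasiShuffle {a} {Ω : Set a} (_⊕_ : Ω → Ω → Ω) where

  qsh : Word Ω → Word Ω → FormalSum Ω
  qsh [] v = v ∷ []
  qsh (x ∷ u) [] = (x ∷ u) ∷ []
  qsh (x ∷ u) (y ∷ v) =
    map (x ∷_) (qsh u (y ∷ v)) ++ map (y ∷_) (qsh (x ∷ u) v)
      ++ map ((x ⊕ y) ∷_) (qsh u v)

  _⧢_ : FormalSum Ω → FormalSum Ω → FormalSum Ω
  L ⧢ M = concatMap (λ u → concatMap (λ v → qsh u v) M) L

  ⧢-all : List (Word Ω) → FormalSum Ω
  ⧢-all = foldr (λ w acc → (w ∷ []) ⧢ acc) ([] ∷ [])

  -- equality of formal sums in the K-vector space with basis the words:
  -- two formal sums are equal iff every linear functional (determined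
  -- by an arbitrary function on the basis of words) agrees on them.
  module _ {c ℓ} (K : Field c ℓ) where
    open Field K
    eval : (Word Ω → Carrier) → FormalSum Ω → Carrier
    eval f = foldr (λ w acc → f w + acc) 0#

    _≈V_ : FormalSum Ω → FormalSum Ω → Set (a ⊔ c ⊔ ℓ)
    L ≈V M = ∀ (f : Word Ω → Carrier) → eval f L ≈ eval f M

-- Maps {1..n} → {1..m} are represented as vectors Vec (Fin m) n
-- (0-indexed: position i stands for i+1).

module _ {n m : ℕ} where

  Surjective : Vec (Fin m) n → Set
  Surjective f = ∀ (k : Fin m) → ∃ λ j → lookup f j ≡ k

  Nondecreasing : Vec (Fin m) n → Set
  Nondecreasing f = ∀ (i j : Fin n) → i ≤ᶠ j → lookup f i ≤ᶠ lookup f j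

  IsQsh : ℕ → Vec (Fin m) n → Set
  IsQsh a f = Surjective f
    × (∀ (i j : Fin n) → i <ᶠ j → toℕ j ℕ.< a → lookup f i <ᶠ lookup f j)
    × (∀ (i j : Fin n) → i <ᶠ j → a ℕ.≤ toℕ i → lookup f i <ᶠ lookup f j)

  IsWeakQsh : ℕ → Vec (Fin m) n → Set
  IsWeakQsh a f = Surjective f
    × (∀ (i j : Fin n) → i ≤ᶠ j → toℕ j ℕ.< a → lookup f i ≤ᶠ lookup f j)
    × (∀ (i j : Fin n) → i ≤ᶠ j → a ℕ.≤ toℕ i → lookup f i ≤ᶠ lookup f j)

InQshφ : ∀ {n s m} (p : ℕ) (φ : Vec (Fin s) n) (η : Vec (Fin m) n) → Set
InQshφ {n} {s} {m} p φ η =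
    IsQsh p η
  × (∀ (i j : Fin n) → lookup φ i <ᶠ lookup φ j → lookup η i <ᶠ lookup η j)
  × (∃ λ (τ : Fin m → Fin s) → ∀ (j : Fin n) → lookup φ j ≡ τ (lookup η j))

subword : ∀ {b} {A : Set b} {n m} → Vec A n → Vec (Fin m) n → Fin m → List A
subword {n = n} ω σ k =
  map (lookup ω) (filter (λ j → lookup σ j ≟ k) (allFin n))

module Contract {a} {Ω : Set a} (_⊕_ : Ω → Ω → Ω) where

  -- semigroup sum of a list, `nothing` for the empty list (Ω has no unit)
  sum⁺ : List Ω → Maybe Ω
  sum⁺ [] = nothing
  sum⁺ (x ∷ xs) with sum⁺ xs
  ... | nothing = just x
  ... | just y  = just (x ⊕ y)

  -- letters of ω^σ : ω^σ_k = [Σ_{σ_j = k} ω_j]  (always `just` when σ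
  -- is surjective, which is the case wherever it is used)
  contract : ∀ {n m} → Vec Ω n → Vec (Fin m) n → Vec (Maybe Ω) m
  contract ω σ = tabulate λ k → sum⁺ (subword ω σ k)

  subOfContract : ∀ {n m s} → Vec Ω n → Vec (Fin m) n → Vec (Fin s) m
                → Fin s → Word Ω
  subOfContract ω η τ k = catMaybes (subword (contract ω η) τ k)

QEntry : ℕ → ℕ → Set
QEntry n s = Σ ℕ λ m → Vec (Fin m) n × Vec (Fin s) m

entryη : ∀ {n s} → QEntry n s → Σ ℕ λ m → Vec (Fin m) n
entryη (m , η , _) = m , η

-- E lists every η ∈ qsh_φ(p,q) exactly once, paired with σ[η], the
-- (unique) nondecreasing surjection with φ = σ[η] ∘ η.
IsEnumeration : ∀ {n s} (p : ℕ) (φ : Vec (Fin s) n) → List (QEntry n s) → Set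
IsEnumeration {n} {s} p φ E =
    All (λ { (m , η , τ) → InQshφ p φ η × Surjective τ × Nondecreasing τ
                         × (∀ (j : Fin n) → lookup φ j ≡ lookup τ (lookup η j)) }) E
  × Unique (map entryη E)
  × (∀ m (η : Vec (Fin m) n) → InQshφ p φ η → (m , η) ∈ map entryη E)

module Sides {a} {Ω : Set a} (_⊕_ : Ω → Ω → Ω) where
  open QuasiShuffle _⊕_
  open Contract _⊕_

  lhs : ∀ {n s} → Vec Ω n → List (QEntry n s) → FormalSum Ω
  lhs {s = s} ω E =
    concatMap (λ e → ⧢-all (map (subOfContract ω (proj₁ (proj₂ e)) (proj₂ (proj₂ e)))
                                (allFin s))) E

  rhs : ∀ {n t} → Vec Ω n → Vec (Fin t) n → FormalSum Ω
  rhs {t = t} ω σ = ⧢-all (map (subword ω σ) (allFin t))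

module Submission where

-- Write ω = wL ++ wR and φ = fL ++ fR, where fL, fR are sorted since φ is a weak quasi-shuffle.
-- A (p,q)-quasi-shuffle η is a lattice path through the two halves, and η ∈ qsh_φ(p,q) exactly when
-- the path always advances on the side(s) carrying the smallest remaining label.  Peeling off the
-- block of smallest labels therefore factors the left-hand side as (wL¹ ⧢ wR¹) ⧢ (the same sum for
-- the remaining labels), so by induction it equals ⧢ₖ (wLᵏ ⧢ wRᵏ) = (⧢ₖ wLᵏ) ⧢ (⧢ₖ wRᵏ), the fibres
-- taken along fL and fR.  Since δ is increasing below and above σ_p, fL and σL (fR and σR) cut their
-- halves into the same blocks, and σ sends the halves to disjoint labels; hence this is ⧢ₖ ω^k_σ.
-- Every step is a rearrangement of formal sums, so the identity is proved up to permutation of the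
-- lists of words, which implies equality in the vector space.

open import Level using (Level)
open import Algebra.Structures using (IsCommutativeSemigroup)
import Algebra.Solver.CommutativeMonoid
open import Data.Bool using (Bool; true; false; if_then_else_)
open import Data.Empty using (⊥-elim)
open import Data.Fin as Fin using (Fin; zero; suc; toℕ; fromℕ; _<_; _≤_; _↑ˡ_; _↑ʳ_)
open import Data.Fin.Properties
  using (_≟_; _≤?_; suc-injective; 0≢1+n; toℕ<n; toℕ-↑ˡ; toℕ-↑ʳ; toℕ-fromℕ; <-cmp; <-irrefl)
open import Data.List as List using (List; []; _∷_; _++_; [_]; concatMap; catMaybes; allFin)
import Data.List.Properties as List
open import Data.List.Membership.Propositional using (_∈_)
open import Data.List.Membership.Propositional.Properties using (∈-map⁺; ∈-map⁻; ∈-++⁺ˡ; ∈-++⁺ʳ; ∈-++⁻)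
open import Data.List.Membership.Propositional.Properties.WithK using (unique∧set⇒bag)
open import Data.List.Relation.Binary.BagAndSetEquality using (∼bag⇒↭)
open import Data.List.Relation.Binary.Permutation.Propositional as ↭
  using (_↭_; ↭-refl; ↭-trans; ↭-reflexive; module PermutationReasoning)
open import Data.List.Relation.Binary.Permutation.Propositional.Properties
  using (++⁺; ++⁺ˡ; shifts; map⁺; ++-commutativeMonoid)
open import Data.List.Relation.Unary.All as All using ([])
open import Data.List.Relation.Unary.AllPairs using ([]; _∷_)
open import Data.List.Relation.Unary.Any using (here)
open import Data.List.Relation.Unary.Unique.Propositional using (Unique)
import Data.List.Relation.Unary.Unique.Propositional.Properties as Unique
open import Data.Maybe using (just)
open import Data.Nat as ℕ using (ℕ; zero; suc; _+_; _∸_; z≤n; s≤s; s<s; z<s; s≤s⁻¹; s<s⁻¹)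
import Data.Nat.Properties as ℕ
open import Data.Product using (Σ; ∃; _×_; _,_; proj₂; map₂)
open import Data.Sum as Sum using (_⊎_; inj₁; inj₂)
open import Data.Unit using (⊤; tt)
open import Data.Vec as Vec using (Vec; []; _∷_; lookup; replicate; toList)
import Data.Vec.Properties as Vec
open import Function using (id; const; _∘_)
open import Function.Bundles using (mk⇔)
open import Relation.Binary.Definitions using (tri<; tri≈; tri>)
open import Relation.Binary.PropositionalEquality as ≡
  using (_≡_; _≢_; refl; sym; trans; cong; cong₂; subst; subst₂; module ≡-Reasoning)
open import Relation.Nullary using (Dec; yes; no; does; ¬_)
open import Relation.Nullary.Decidable using (does-≡; does-⇔; map′)
open import Defs

private variable
  b : Level
  A B : Set b
  m n n′ p q s a₀ b₀ : ℕ

-- Fibres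

-- Defs.subword by structural recursion, which is what the proofs compute with.
fibre : Vec A n → Vec (Fin s) n → Fin s → List A
fibre []      []      k = []
fibre (x ∷ w) (i ∷ μ) k = if does (i ≟ k) then x ∷ fibre w μ k else fibre w μ k

private
  filter-map-suc : (x : A) (w : Vec A n) (i : Fin s) (μ : Vec (Fin s) n) (k : Fin s) (js : List (Fin n)) →
    List.map (lookup (x ∷ w)) (List.filter (λ j → lookup (i ∷ μ) j ≟ k) (List.map suc js))
      ≡ List.map (lookup w) (List.filter (λ j → lookup μ j ≟ k) js)
  filter-map-suc x w i μ k []       = refl
  filter-map-suc x w i μ k (j ∷ js) with does (lookup μ j ≟ k)
  ... | true  = cong (lookup w j ∷_) (filter-map-suc x w i μ k js)
  ... | false = filter-map-suc x w i μ k js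

  subword-tail : (x : A) (w : Vec A n) (i : Fin s) (μ : Vec (Fin s) n) (k : Fin s) →
    List.map (lookup (x ∷ w)) (List.filter (λ j → lookup (i ∷ μ) j ≟ k) (List.tabulate suc)) ≡ subword w μ k
  subword-tail {n = n} x w i μ k =
    trans (cong (λ js → List.map (lookup (x ∷ w)) (List.filter (λ j → lookup (i ∷ μ) j ≟ k) js))
                (sym (List.map-tabulate id suc)))
          (filter-map-suc x w i μ k (allFin n))

subword≡fibre : (w : Vec A n) (μ : Vec (Fin s) n) (k : Fin s) → subword w μ k ≡ fibre w μ k
subword≡fibre []      []      k = refl
subword≡fibre (x ∷ w) (i ∷ μ) k with does (i ≟ k)
... | true  = cong (x ∷_) (trans (subword-tail x w i μ k) (subword≡fibre w μ k))
... | false = trans (subword-tail x w i μ k) (subword≡fibre w μ k)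

fibre-++ : (u : Vec A m) (v : Vec A n) (μ : Vec (Fin s) m) (ν : Vec (Fin s) n) (k : Fin s) →
           fibre (u Vec.++ v) (μ Vec.++ ν) k ≡ fibre u μ k ++ fibre v ν k
fibre-++ []      v []      ν k = refl
fibre-++ (x ∷ u) v (i ∷ μ) ν k with does (i ≟ k)
... | true  = cong (x ∷_) (fibre-++ u v μ ν k)
... | false = fibre-++ u v μ ν k

fibre-∉ : (w : Vec A n) (μ : Vec (Fin s) n) (k : Fin s) → (∀ i → lookup μ i ≢ k) → fibre w μ k ≡ []
fibre-∉ []      []      k k∉μ = refl
fibre-∉ (x ∷ w) (i ∷ μ) k k∉μ with i ≟ k
... | yes i≡k = ⊥-elim (k∉μ zero i≡k)
... | no  _   = fibre-∉ w μ k (λ j → k∉μ (suc j))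

fibre-map-suc-zero : (w : Vec A n) (μ : Vec (Fin s) n) → fibre w (Vec.map suc μ) zero ≡ []
fibre-map-suc-zero []      []      = refl
fibre-map-suc-zero (x ∷ w) (i ∷ μ) = fibre-map-suc-zero w μ

fibre-map-suc : (w : Vec A n) (μ : Vec (Fin s) n) (k : Fin s) → fibre w (Vec.map suc μ) (suc k) ≡ fibre w μ k
fibre-map-suc []      []      k = refl
fibre-map-suc (x ∷ w) (i ∷ μ) k with does (i ≟ k)
... | true  = cong (x ∷_) (fibre-map-suc w μ k)
... | false = fibre-map-suc w μ k

fibre-replicate-zero : (w : Vec A n) → fibre w (replicate n (zero {s})) zero ≡ toList w
fibre-replicate-zero []      = refl
fibre-replicate-zero (x ∷ w) = cong (x ∷_) (fibre-replicate-zero w)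

fibre-replicate-suc : (w : Vec A n) (k : Fin s) → fibre w (replicate n zero) (suc k) ≡ []
fibre-replicate-suc []      k = refl
fibre-replicate-suc (x ∷ w) k = fibre-replicate-suc w k

Nondecreasing-tail : ∀ {x : Fin s} {v : Vec (Fin s) n} → Nondecreasing (x ∷ v) → Nondecreasing v
Nondecreasing-tail nd i j i≤j = nd (suc i) (suc j) (s≤s i≤j)

Nondecreasing-unsuc : ∀ {v : Vec (Fin s) n} → Nondecreasing (Vec.map suc v) → Nondecreasing v
Nondecreasing-unsuc {v = v} nd i j i≤j =
  ℕ.≤-pred (subst₂ ℕ._≤_ (cong toℕ (Vec.lookup-map i suc v)) (cong toℕ (Vec.lookup-map j suc v)) (nd i j i≤j))

strip-suc : (v : Vec (Fin (suc s)) n) → (∀ i → lookup v i ≢ zero) → Σ (Vec (Fin s) n) λ v′ → v ≡ Vec.map suc v′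
strip-suc []          nz = [] , refl
strip-suc (zero ∷ v)  nz = ⊥-elim (nz zero refl)
strip-suc (suc x ∷ v) nz with strip-suc v (λ i → nz (suc i))
... | v′ , refl = x ∷ v′ , refl

data ZeroBlock {s} : Vec (Fin (suc s)) n → Set where
  zeroBlock : ∀ a {n′} (v : Vec (Fin s) n′) → Nondecreasing v → ZeroBlock (replicate a zero Vec.++ Vec.map suc v)

zeroBlock-view : (v : Vec (Fin (suc s)) n) → Nondecreasing v → ZeroBlock v
zeroBlock-view []          nd = zeroBlock 0 [] (λ ())
zeroBlock-view (zero ∷ v)  nd with zeroBlock-view v (Nondecreasing-tail nd)
... | zeroBlock a v′ nd′ = zeroBlock (suc a) v′ nd′
zeroBlock-view (suc x ∷ v) nd with strip-suc v positive
  where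
  positive : ∀ i → lookup v i ≢ zero
  positive i v[i]≡0 = ℕ.n≮0 (subst (λ y → 0 ℕ.< toℕ y) v[i]≡0 (ℕ.<-≤-trans z<s (nd zero (suc i) z≤n)))
... | v′ , refl = zeroBlock 0 (x ∷ v′) (Nondecreasing-unsuc {v = x ∷ v′} nd)

fibre-zeroBlock-zero : (w₀ : Vec A a₀) (w : Vec A n) (μ : Vec (Fin s) n) →
                       fibre (w₀ Vec.++ w) (replicate a₀ zero Vec.++ Vec.map suc μ) zero ≡ toList w₀
fibre-zeroBlock-zero w₀ w μ = begin
  fibre (w₀ Vec.++ w) (replicate _ zero Vec.++ Vec.map suc μ) zero ≡⟨ fibre-++ w₀ w _ _ zero ⟩
  fibre w₀ (replicate _ zero) zero ++ fibre w (Vec.map suc μ) zero ≡⟨ cong₂ _++_ (fibre-replicate-zero w₀) (fibre-map-suc-zero w μ) ⟩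
  toList w₀ ++ []                                                   ≡⟨ List.++-identityʳ _ ⟩
  toList w₀                                                         ∎
  where open ≡-Reasoning

fibre-zeroBlock-suc : (w₀ : Vec A a₀) (w : Vec A n) (μ : Vec (Fin s) n) (k : Fin s) →
                      fibre (w₀ Vec.++ w) (replicate a₀ zero Vec.++ Vec.map suc μ) (suc k) ≡ fibre w μ k
fibre-zeroBlock-suc w₀ w μ k = begin
  fibre (w₀ Vec.++ w) (replicate _ zero Vec.++ Vec.map suc μ) (suc k)    ≡⟨ fibre-++ w₀ w _ _ (suc k) ⟩
  fibre w₀ (replicate _ zero) (suc k) ++ fibre w (Vec.map suc μ) (suc k) ≡⟨ cong₂ _++_ (fibre-replicate-suc w₀ k) (fibre-map-suc w μ k) ⟩
  fibre w μ k                                                            ∎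
  where open ≡-Reasoning

-- Lattice paths

-- A (p,q)-quasi-shuffle as a lattice path: each step takes the next letter of the left word,
-- of the right word, or of both.
data Path : ℕ → ℕ → Set where
  end   : Path 0 0
  left  : Path p q → Path (suc p) q
  right : Path p q → Path p (suc q)
  both  : Path p q → Path (suc p) (suc q)

length : Path p q → ℕ
length end       = 0
length (left π)  = suc (length π)
length (right π) = suc (length π)
length (both π)  = suc (length π)

merge : (A → A → A) → (π : Path p q) → Vec A p → Vec A q → Vec A (length π)
merge f end       []      []      = []
merge f (left π)  (x ∷ u) v       = x ∷ merge f π u v
merge f (right π) u       (y ∷ v) = y ∷ merge f π u v
merge f (both π)  (x ∷ u) (y ∷ v) = f x y ∷ merge f π u v

leftPositions  : (π : Path p q) → Vec (Fin (length π)) p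
rightPositions : (π : Path p q) → Vec (Fin (length π)) q
leftPositions end        = []
leftPositions (left π)   = zero ∷ Vec.map suc (leftPositions π)
leftPositions (right π)  = Vec.map suc (leftPositions π)
leftPositions (both π)   = zero ∷ Vec.map suc (leftPositions π)
rightPositions end       = []
rightPositions (left π)  = Vec.map suc (rightPositions π)
rightPositions (right π) = zero ∷ Vec.map suc (rightPositions π)
rightPositions (both π)  = zero ∷ Vec.map suc (rightPositions π)

positions : (π : Path p q) → Vec (Fin (length π)) (p + q)
positions π = leftPositions π Vec.++ rightPositions π

-- σ[η] for η = positions π; a `both` step takes its label from the left (on qshφ the two agree).
labels : (π : Path p q) → Vec (Fin s) p → Vec (Fin s) q → Vec (Fin s) (length π)
labels = merge const

labels-map-suc : (π : Path p q) (fL : Vec (Fin s) p) (fR : Vec (Fin s) q) →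
                 labels π (Vec.map suc fL) (Vec.map suc fR) ≡ Vec.map suc (labels π fL fR)
labels-map-suc end       []       []       = refl
labels-map-suc (left π)  (k ∷ fL) fR       = cong (suc k ∷_) (labels-map-suc π fL fR)
labels-map-suc (right π) fL       (l ∷ fR) = cong (suc l ∷_) (labels-map-suc π fL fR)
labels-map-suc (both π)  (k ∷ fL) (l ∷ fR) = cong (suc k ∷_) (labels-map-suc π fL fR)

_++ᵖ_ : Path a₀ b₀ → Path p q → Path (a₀ + p) (b₀ + q)
end     ++ᵖ ρ = ρ
left π  ++ᵖ ρ = left (π ++ᵖ ρ)
right π ++ᵖ ρ = right (π ++ᵖ ρ)
both π  ++ᵖ ρ = both (π ++ᵖ ρ)

allPaths : ∀ p q → List (Path p q)
allPaths zero    zero    = end ∷ []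
allPaths (suc p) zero    = List.map left (allPaths p zero)
allPaths zero    (suc q) = List.map right (allPaths zero q)
allPaths (suc p) (suc q) =
  List.map left (allPaths p (suc q)) ++ List.map right (allPaths (suc p) q) ++ List.map both (allPaths p q)

when : ∀ {ℓ} {P : Set ℓ} → Dec P → List A → List A
when P? xs = if does P? then xs else []

-- The paths that always advance on the side(s) with the smaller next label; for sorted fL and fR
-- they encode qsh_φ(p,q) with φ = fL ++ fR.
qshφ : Vec (Fin s) p → Vec (Fin s) q → List (Path p q)
qshφ []       []       = end ∷ []
qshφ (k ∷ fL) []       = List.map left (qshφ fL [])
qshφ []       (l ∷ fR) = List.map right (qshφ [] fR)
qshφ (k ∷ fL) (l ∷ fR) =
  when (k ≤? l) (List.map left (qshφ fL (l ∷ fR))) ++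
  when (l ≤? k) (List.map right (qshφ (k ∷ fL) fR)) ++
  when (k ≟ l)  (List.map both (qshφ fL fR))

private
  does-≤?-suc : (k l : Fin s) → does (suc k ≤? suc l) ≡ does (k ≤? l)
  does-≤?-suc k l = does-≡ (suc k ≤? suc l) (map′ s≤s s≤s⁻¹ (k ≤? l))

qshφ-map-suc : (fL : Vec (Fin s) p) (fR : Vec (Fin s) q) → qshφ (Vec.map suc fL) (Vec.map suc fR) ≡ qshφ fL fR
qshφ-map-suc []       []       = refl
qshφ-map-suc (k ∷ fL) []       = cong (List.map left) (qshφ-map-suc fL [])
qshφ-map-suc []       (l ∷ fR) = cong (List.map right) (qshφ-map-suc [] fR)
qshφ-map-suc (k ∷ fL) (l ∷ fR)
  rewrite qshφ-map-suc fL (l ∷ fR) | qshφ-map-suc (k ∷ fL) fR | qshφ-map-suc fL fR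
        | does-≤?-suc k l | does-≤?-suc l k = refl

prefixAll : List (Path a₀ b₀) → List (Path p q) → List (Path (a₀ + p) (b₀ + q))
prefixAll Π G = concatMap (λ π → List.map (π ++ᵖ_) G) Π

private
  prefixAll-map : ∀ {a₁ b₁} (c : Path a₀ b₀ → Path a₁ b₁) (c′ : Path (a₀ + p) (b₀ + q) → Path (a₁ + p) (b₁ + q)) →
                  (∀ π ρ → c π ++ᵖ ρ ≡ c′ (π ++ᵖ ρ)) → ∀ Π (G : List (Path p q)) →
                  prefixAll (List.map c Π) G ≡ List.map c′ (prefixAll Π G)
  prefixAll-map c c′ comm []      G = refl
  prefixAll-map c c′ comm (π ∷ Π) G =
    trans (cong₂ _++_ (trans (List.map-cong (comm π) G) (List.map-∘ G)) (prefixAll-map c c′ comm Π G))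
          (sym (List.map-++ c′ _ (prefixAll Π G)))

  prefixAll-left : ∀ Π (G : List (Path p q)) → prefixAll (List.map (left {a₀} {b₀}) Π) G ≡ List.map left (prefixAll Π G)
  prefixAll-left = prefixAll-map left left (λ _ _ → refl)

  prefixAll-right : ∀ Π (G : List (Path p q)) → prefixAll (List.map (right {a₀} {b₀}) Π) G ≡ List.map right (prefixAll Π G)
  prefixAll-right = prefixAll-map right right (λ _ _ → refl)

qshφ-zeroBlocks : ∀ a₀ b₀ (fL : Vec (Fin s) p) (fR : Vec (Fin s) q) →
  qshφ (replicate a₀ zero Vec.++ Vec.map suc fL) (replicate b₀ zero Vec.++ Vec.map suc fR)
    ≡ prefixAll (allPaths a₀ b₀) (qshφ fL fR)
qshφ-zeroBlocks zero     zero     fL       fR       =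
  trans (qshφ-map-suc fL fR) (sym (trans (List.++-identityʳ _) (List.map-id _)))
qshφ-zeroBlocks (suc a₀) zero     fL       []       =
  trans (cong (List.map left) (qshφ-zeroBlocks a₀ zero fL [])) (sym (prefixAll-left (allPaths a₀ 0) (qshφ fL [])))
qshφ-zeroBlocks (suc a₀) zero     fL       (l ∷ fR) = trans (List.++-identityʳ _)
  (trans (cong (List.map left) (qshφ-zeroBlocks a₀ zero fL (l ∷ fR))) (sym (prefixAll-left (allPaths a₀ 0) (qshφ fL (l ∷ fR)))))
qshφ-zeroBlocks zero     (suc b₀) []       fR       =
  trans (cong (List.map right) (qshφ-zeroBlocks zero b₀ [] fR)) (sym (prefixAll-right (allPaths 0 b₀) (qshφ [] fR)))
qshφ-zeroBlocks zero     (suc b₀) (k ∷ fL) fR       = trans (List.++-identityʳ _)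
  (trans (cong (List.map right) (qshφ-zeroBlocks zero b₀ (k ∷ fL) fR)) (sym (prefixAll-right (allPaths 0 b₀) (qshφ (k ∷ fL) fR))))
qshφ-zeroBlocks (suc a₀) (suc b₀) fL       fR       = begin
  List.map left (qshφ (Z a₀ fL) (Z (suc b₀) fR)) ++ List.map right (qshφ (Z (suc a₀) fL) (Z b₀ fR))
    ++ List.map both (qshφ (Z a₀ fL) (Z b₀ fR))
    ≡⟨ cong₂ _++_ (cong (List.map left) (qshφ-zeroBlocks a₀ (suc b₀) fL fR))
         (cong₂ _++_ (cong (List.map right) (qshφ-zeroBlocks (suc a₀) b₀ fL fR)) (cong (List.map both) (qshφ-zeroBlocks a₀ b₀ fL fR))) ⟩
  List.map left (prefixAll Πˡ G) ++ List.map right (prefixAll Πʳ G) ++ List.map both (prefixAll Πᵇ G)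
    ≡⟨ sym (cong₂ _++_ (prefixAll-left Πˡ G) (cong₂ _++_ (prefixAll-right Πʳ G) (prefixAll-map both both (λ _ _ → refl) Πᵇ G))) ⟩
  prefixAll (List.map left Πˡ) G ++ prefixAll (List.map right Πʳ) G ++ prefixAll (List.map both Πᵇ) G
    ≡⟨ sym (trans (List.concatMap-++ _ (List.map left Πˡ) _)
                  (cong (prefixAll (List.map left Πˡ) G ++_) (List.concatMap-++ _ (List.map right Πʳ) _))) ⟩
  prefixAll (allPaths (suc a₀) (suc b₀)) G ∎
  where
  open ≡-Reasoning
  Z : ∀ a {n} → Vec (Fin s) n → Vec (Fin (suc s)) (a + n)
  Z a v = replicate a zero Vec.++ Vec.map suc v
  G  = qshφ fL fR
  Πˡ = allPaths a₀ (suc b₀)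
  Πʳ = allPaths (suc a₀) b₀
  Πᵇ = allPaths a₀ b₀

private
  map-map : ∀ {c d e} {B : Set c} {C : Set d} {D : Set e} {f : A → B} {g : B → D} {f′ : A → C} {g′ : C → D} →
            (∀ x → g (f x) ≡ g′ (f′ x)) → (xs : List A) → List.map g (List.map f xs) ≡ List.map g′ (List.map f′ xs)
  map-map eq xs = trans (sym (List.map-∘ xs)) (trans (List.map-cong eq xs) (List.map-∘ xs))

module MergedWords {a} {Ω : Set a} (_⊕_ : Ω → Ω → Ω) where
  open QuasiShuffle _⊕_ using (qsh)
  open Contract _⊕_ using (sum⁺; contract; subOfContract)

  merged : Vec Ω p → Vec Ω q → Path p q → List Ω
  merged u v π = toList (merge _⊕_ π u v)

  qsh-[]ʳ : ∀ w → qsh w [] ≡ [ w ]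
  qsh-[]ʳ []      = refl
  qsh-[]ʳ (x ∷ w) = refl

  map-merged-allPaths : (u : Vec Ω p) (v : Vec Ω q) → List.map (merged u v) (allPaths p q) ≡ qsh (toList u) (toList v)
  map-merged-allPaths []      []      = refl
  map-merged-allPaths (x ∷ u) []      = begin
    List.map (merged (x ∷ u) []) (List.map left (allPaths _ 0))   ≡⟨ map-map (λ _ → refl) (allPaths _ 0) ⟩
    List.map (x ∷_) (List.map (merged u []) (allPaths _ 0))       ≡⟨ cong (List.map (x ∷_)) (map-merged-allPaths u []) ⟩
    List.map (x ∷_) (qsh (toList u) [])                            ≡⟨ cong (List.map (x ∷_)) (qsh-[]ʳ (toList u)) ⟩
    [ x ∷ toList u ]                                               ∎
    where open ≡-Reasoning
  map-merged-allPaths []      (y ∷ v) =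
    trans (map-map (λ _ → refl) (allPaths 0 _)) (cong (List.map (y ∷_)) (map-merged-allPaths [] v))
  map-merged-allPaths {p = suc p} {q = suc q} (x ∷ u) (y ∷ v) = begin
    List.map F (List.map left Πˡ ++ List.map right Πʳ ++ List.map both Πᵇ)
      ≡⟨ trans (List.map-++ F (List.map left Πˡ) _) (cong (List.map F (List.map left Πˡ) ++_) (List.map-++ F (List.map right Πʳ) _)) ⟩
    List.map F (List.map left Πˡ) ++ List.map F (List.map right Πʳ) ++ List.map F (List.map both Πᵇ)
      ≡⟨ cong₂ _++_ (map-map (λ _ → refl) Πˡ) (cong₂ _++_ (map-map (λ _ → refl) Πʳ) (map-map (λ _ → refl) Πᵇ)) ⟩
    List.map (x ∷_) (List.map (merged u (y ∷ v)) Πˡ) ++ List.map (y ∷_) (List.map (merged (x ∷ u) v) Πʳ)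
      ++ List.map ((x ⊕ y) ∷_) (List.map (merged u v) Πᵇ)
      ≡⟨ cong₂ _++_ (cong (List.map (x ∷_)) (map-merged-allPaths u (y ∷ v)))
          (cong₂ _++_ (cong (List.map (y ∷_)) (map-merged-allPaths (x ∷ u) v)) (cong (List.map ((x ⊕ y) ∷_)) (map-merged-allPaths u v))) ⟩
    qsh (x ∷ toList u) (y ∷ toList v) ∎
    where
    open ≡-Reasoning
    F = merged (x ∷ u) (y ∷ v)
    Πˡ = allPaths p (suc q)
    Πʳ = allPaths (suc p) q
    Πᵇ = allPaths p q

  fibre-++ᵖ-zero : ∀ {a₀ b₀} (π : Path a₀ b₀) (ρ : Path p q) u₀ (u : Vec Ω p) v₀ (v : Vec Ω q)
                   (fL : Vec (Fin s) p) (fR : Vec (Fin s) q) →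
    fibre (merge _⊕_ (π ++ᵖ ρ) (u₀ Vec.++ u) (v₀ Vec.++ v))
          (labels (π ++ᵖ ρ) (replicate a₀ zero Vec.++ Vec.map suc fL) (replicate b₀ zero Vec.++ Vec.map suc fR)) zero
      ≡ merged u₀ v₀ π
  fibre-++ᵖ-zero end ρ [] u [] v fL fR
    rewrite labels-map-suc ρ fL fR = fibre-map-suc-zero (merge _⊕_ ρ u v) (labels ρ fL fR)
  fibre-++ᵖ-zero (left π)  ρ (x ∷ u₀) u v₀       v fL fR = cong (x ∷_) (fibre-++ᵖ-zero π ρ u₀ u v₀ v fL fR)
  fibre-++ᵖ-zero (right π) ρ u₀       u (y ∷ v₀) v fL fR = cong (y ∷_) (fibre-++ᵖ-zero π ρ u₀ u v₀ v fL fR)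
  fibre-++ᵖ-zero (both π)  ρ (x ∷ u₀) u (y ∷ v₀) v fL fR = cong (x ⊕ y ∷_) (fibre-++ᵖ-zero π ρ u₀ u v₀ v fL fR)

  fibre-++ᵖ-suc : ∀ {a₀ b₀} (π : Path a₀ b₀) (ρ : Path p q) u₀ (u : Vec Ω p) v₀ (v : Vec Ω q)
                  (fL : Vec (Fin s) p) (fR : Vec (Fin s) q) (k : Fin s) →
    fibre (merge _⊕_ (π ++ᵖ ρ) (u₀ Vec.++ u) (v₀ Vec.++ v))
          (labels (π ++ᵖ ρ) (replicate a₀ zero Vec.++ Vec.map suc fL) (replicate b₀ zero Vec.++ Vec.map suc fR)) (suc k)
      ≡ fibre (merge _⊕_ ρ u v) (labels ρ fL fR) k
  fibre-++ᵖ-suc end ρ [] u [] v fL fR k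
    rewrite labels-map-suc ρ fL fR = fibre-map-suc (merge _⊕_ ρ u v) (labels ρ fL fR) k
  fibre-++ᵖ-suc (left π)  ρ (x ∷ u₀) u v₀       v = fibre-++ᵖ-suc π ρ u₀ u v₀ v
  fibre-++ᵖ-suc (right π) ρ u₀       u (y ∷ v₀) v = fibre-++ᵖ-suc π ρ u₀ u v₀ v
  fibre-++ᵖ-suc (both π)  ρ (x ∷ u₀) u (y ∷ v₀) v = fibre-++ᵖ-suc π ρ u₀ u v₀ v

  private
    sum⁺-fibres : (π : Path p q) (u : Vec Ω p) (v : Vec Ω q) (k : Fin (length π)) →
      sum⁺ (fibre u (leftPositions π) k ++ fibre v (rightPositions π) k) ≡ just (lookup (merge _⊕_ π u v) k)
    sum⁺-fibres (left π)  (x ∷ u) v       zero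
      rewrite fibre-map-suc-zero u (leftPositions π) | fibre-map-suc-zero v (rightPositions π) = refl
    sum⁺-fibres (right π) u       (y ∷ v) zero
      rewrite fibre-map-suc-zero u (leftPositions π) | fibre-map-suc-zero v (rightPositions π) = refl
    sum⁺-fibres (both π)  (x ∷ u) (y ∷ v) zero
      rewrite fibre-map-suc-zero u (leftPositions π) | fibre-map-suc-zero v (rightPositions π) = refl
    sum⁺-fibres (left π)  (x ∷ u) v       (suc k)
      rewrite fibre-map-suc u (leftPositions π) k | fibre-map-suc v (rightPositions π) k = sum⁺-fibres π u v k
    sum⁺-fibres (right π) u       (y ∷ v) (suc k)
      rewrite fibre-map-suc u (leftPositions π) k | fibre-map-suc v (rightPositions π) k = sum⁺-fibres π u v k
    sum⁺-fibres (both π)  (x ∷ u) (y ∷ v) (suc k)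
      rewrite fibre-map-suc u (leftPositions π) k | fibre-map-suc v (rightPositions π) k = sum⁺-fibres π u v k

    catMaybes-fibre-just : ∀ {n} (w : Vec Ω n) (τ : Vec (Fin s) n) (k : Fin s) →
                           catMaybes (fibre (Vec.map just w) τ k) ≡ fibre w τ k
    catMaybes-fibre-just []      []      k = refl
    catMaybes-fibre-just (x ∷ w) (i ∷ τ) k with does (i ≟ k)
    ... | true  = cong (x ∷_) (catMaybes-fibre-just w τ k)
    ... | false = catMaybes-fibre-just w τ k

  contract-positions : (π : Path p q) (u : Vec Ω p) (v : Vec Ω q) →
                       contract (u Vec.++ v) (positions π) ≡ Vec.map just (merge _⊕_ π u v)
  contract-positions π u v = begin
    Vec.tabulate (λ k → sum⁺ (subword (u Vec.++ v) (positions π) k))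
      ≡⟨ Vec.tabulate-cong (λ k → cong sum⁺ (trans (subword≡fibre (u Vec.++ v) (positions π) k) (fibre-++ u v _ _ k))) ⟩
    Vec.tabulate (λ k → sum⁺ (fibre u (leftPositions π) k ++ fibre v (rightPositions π) k))
      ≡⟨ Vec.tabulate-cong (sum⁺-fibres π u v) ⟩
    Vec.tabulate (just ∘ lookup (merge _⊕_ π u v))
      ≡⟨ Vec.tabulate-∘ just (lookup (merge _⊕_ π u v)) ⟩
    Vec.map just (Vec.tabulate (lookup (merge _⊕_ π u v)))
      ≡⟨ cong (Vec.map just) (Vec.tabulate∘lookup _) ⟩
    Vec.map just (merge _⊕_ π u v) ∎
    where open ≡-Reasoning

  subOfContract-positions : (π : Path p q) (u : Vec Ω p) (v : Vec Ω q) (τ : Vec (Fin s) (length π)) (k : Fin s) →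
                            subOfContract (u Vec.++ v) (positions π) τ k ≡ fibre (merge _⊕_ π u v) τ k
  subOfContract-positions π u v τ k = begin
    catMaybes (subword (contract (u Vec.++ v) (positions π)) τ k) ≡⟨ cong catMaybes (subword≡fibre (contract (u Vec.++ v) (positions π)) τ k) ⟩
    catMaybes (fibre (contract (u Vec.++ v) (positions π)) τ k)   ≡⟨ cong (λ c → catMaybes (fibre c τ k)) (contract-positions π u v) ⟩
    catMaybes (fibre (Vec.map just (merge _⊕_ π u v)) τ k)         ≡⟨ catMaybes-fibre-just (merge _⊕_ π u v) τ k ⟩
    fibre (merge _⊕_ π u v) τ k                                     ∎
    where open ≡-Reasoning

-- Quasi-shuffles as paths

StrictlyIncreasing : Vec (Fin m) n → Set
StrictlyIncreasing v = ∀ i j → i < j → lookup v i < lookup v j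

record IsQshPair (ηL : Vec (Fin m) p) (ηR : Vec (Fin m) q) : Set where
  field
    increasingˡ : StrictlyIncreasing ηL
    increasingʳ : StrictlyIncreasing ηR
    covering    : ∀ k → (∃ λ i → lookup ηL i ≡ k) ⊎ (∃ λ j → lookup ηR j ≡ k)
open IsQshPair

lookup-map-suc : (v : Vec (Fin m) n) (i : Fin n) → lookup (Vec.map Fin.suc v) i ≡ Fin.suc (lookup v i)
lookup-map-suc v i = Vec.lookup-map i Fin.suc v

<-map-suc : (u : Vec (Fin m) n) (v : Vec (Fin m) n′) {i : Fin n} {j : Fin n′} →
            lookup u i < lookup v j → lookup (Vec.map Fin.suc u) i < lookup (Vec.map Fin.suc v) j
<-map-suc u v {i} {j} lt = subst₂ _<_ (sym (lookup-map-suc u i)) (sym (lookup-map-suc v j)) (s<s lt)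

≡-map-suc⁻ : (u : Vec (Fin m) n) (v : Vec (Fin m) n′) {i : Fin n} {j : Fin n′} →
             lookup (Vec.map Fin.suc u) i ≡ lookup (Vec.map Fin.suc v) j → lookup u i ≡ lookup v j
≡-map-suc⁻ u v {i} {j} eq = suc-injective (trans (sym (lookup-map-suc u i)) (trans eq (lookup-map-suc v j)))

zero<map-suc : ∀ {m} (v : Vec (Fin m) n) (j : Fin n) → zero {m} < lookup (Vec.map Fin.suc v) j
zero<map-suc {m} v j = subst (zero {m} <_) (sym (lookup-map-suc v j)) z<s

zero≢map-suc : (v : Vec (Fin m) n) (j : Fin n) → zero ≢ lookup (Vec.map Fin.suc v) j
zero≢map-suc v j eq = 0≢1+n (trans eq (lookup-map-suc v j))

-- How the positions of one half change along a step: the half either sits the step out (keep)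
-- or supplies the letter at its first position (new).
data Shift {m} : Vec (Fin (suc m)) n′ → Vec (Fin m) n → Set where
  keep : (y : Vec (Fin m) n) → Shift (Vec.map suc y) y
  new  : (y : Vec (Fin m) n) → Shift (zero ∷ Vec.map suc y) y

module _ {x : Vec (Fin (suc m)) n′} {y : Vec (Fin m) n} where

  embed : Shift x y → Fin n → Fin n′
  embed (keep _) i = i
  embed (new _)  i = suc i

  lookup-embed : (sh : Shift x y) (i : Fin n) → lookup x (embed sh i) ≡ suc (lookup y i)
  lookup-embed (keep y) i = lookup-map-suc y i
  lookup-embed (new y)  i = lookup-map-suc y i

  embed-monotone : (sh : Shift x y) {i j : Fin n} → i < j → embed sh i < embed sh j
  embed-monotone (keep _) i<j = i<j
  embed-monotone (new _)  i<j = s<s i<j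

  unshift : (sh : Shift x y) {k : Fin m} → ∃ (λ i′ → lookup x i′ ≡ suc k) → ∃ λ i → lookup y i ≡ k
  unshift (keep y) (i , eq)     = i , suc-injective (trans (sym (lookup-map-suc y i)) eq)
  unshift (new y)  (zero , ())
  unshift (new y)  (suc i , eq) = i , suc-injective (trans (sym (lookup-map-suc y i)) eq)

  shift : (sh : Shift x y) {k : Fin m} → ∃ (λ i → lookup y i ≡ k) → ∃ λ i′ → lookup x i′ ≡ suc k
  shift sh (i , eq) = embed sh i , trans (lookup-embed sh i) (cong suc eq)

  StrictlyIncreasing-shift : Shift x y → StrictlyIncreasing y → StrictlyIncreasing x
  StrictlyIncreasing-shift (keep y) inc i       j       i<j = <-map-suc y y (inc i j i<j)
  StrictlyIncreasing-shift (new y)  inc zero    (suc j) _   = zero<map-suc y j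
  StrictlyIncreasing-shift (new y)  inc (suc i) (suc j) i<j = <-map-suc y y (inc i j (s<s⁻¹ i<j))

lookup-embed-< : ∀ {n₁ n₂ p₁ p₂} {x₁ : Vec (Fin (suc m)) n₁} {x₂ : Vec (Fin (suc m)) n₂}
                 {y₁ : Vec (Fin m) p₁} {y₂ : Vec (Fin m) p₂} (sh₁ : Shift x₁ y₁) (sh₂ : Shift x₂ y₂) {i j} →
                 lookup x₁ (embed sh₁ i) < lookup x₂ (embed sh₂ j) → lookup y₁ i < lookup y₂ j
lookup-embed-< sh₁ sh₂ {i} {j} lt = s<s⁻¹ (subst₂ _<_ (lookup-embed sh₁ i) (lookup-embed sh₂ j) lt)

module _ {xL : Vec (Fin (suc m)) n} {xR : Vec (Fin (suc m)) n′} {yL : Vec (Fin m) p} {yR : Vec (Fin m) q} where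

  IsQshPair-unshift : Shift xL yL → Shift xR yR → IsQshPair xL xR → IsQshPair yL yR
  IsQshPair-unshift shL shR η = record
    { increasingˡ = λ i j i<j → lookup-embed-< shL shL (increasingˡ η _ _ (embed-monotone shL i<j))
    ; increasingʳ = λ i j i<j → lookup-embed-< shR shR (increasingʳ η _ _ (embed-monotone shR i<j))
    ; covering    = λ k → Sum.map (unshift shL) (unshift shR) (covering η (suc k))
    }

  IsQshPair-shift : Shift xL yL → Shift xR yR → ∃ (λ i → lookup xL i ≡ zero) ⊎ ∃ (λ j → lookup xR j ≡ zero) →
                    IsQshPair yL yR → IsQshPair xL xR
  IsQshPair-shift shL shR zero-covered η = record
    { increasingˡ = StrictlyIncreasing-shift shL (increasingˡ η)
    ; increasingʳ = StrictlyIncreasing-shift shR (increasingʳ η)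
    ; covering    = λ { zero → zero-covered ; (suc k) → Sum.map (shift shL) (shift shR) (covering η k) }
    }

positions-isQshPair : (π : Path p q) → IsQshPair (leftPositions π) (rightPositions π)
positions-isQshPair end       = record { increasingˡ = λ () ; increasingʳ = λ () ; covering = λ () }
positions-isQshPair (left π)  = IsQshPair-shift (new _)  (keep _) (inj₁ (zero , refl)) (positions-isQshPair π)
positions-isQshPair (right π) = IsQshPair-shift (keep _) (new _)  (inj₂ (zero , refl)) (positions-isQshPair π)
positions-isQshPair (both π)  = IsQshPair-shift (new _)  (new _)  (inj₁ (zero , refl)) (positions-isQshPair π)

private
  nonzero-above : ∀ {a b : Fin (suc m)} → a < b → b ≢ zero
  nonzero-above a<b refl = ℕ.n≮0 a<b

shiftView : (x : Vec (Fin (suc m)) n) → StrictlyIncreasing x → Σ ℕ λ n′ → Σ (Vec (Fin m) n′) (Shift x)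
shiftView []          inc = _ , [] , keep []
shiftView (zero ∷ x)  inc with strip-suc x (λ i → nonzero-above (inc zero (suc i) z<s))
... | y , refl = _ , y , new y
shiftView (suc a ∷ x) inc with strip-suc x (λ i → nonzero-above (inc zero (suc i) z<s))
... | y , refl = _ , a ∷ y , keep (a ∷ y)

PositionPair : ℕ → ℕ → Set
PositionPair p q = Σ ℕ λ m → Vec (Fin m) p × Vec (Fin m) q

positionPair : Path p q → PositionPair p q
positionPair π = length π , leftPositions π , rightPositions π

decode : ∀ m (ηL : Vec (Fin m) p) (ηR : Vec (Fin m) q) → IsQshPair ηL ηR → ∃ λ π → positionPair π ≡ (m , ηL , ηR)
decode zero    []       []       η = end , refl
decode zero    (() ∷ _) _        η
decode zero    []       (() ∷ _) η
decode (suc m) ηL ηR η with shiftView ηL (increasingˡ η) | shiftView ηR (increasingʳ η)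
... | _ , yL , new .yL  | _ , yR , keep .yR with decode m yL yR (IsQshPair-unshift (new yL) (keep yR) η)
...   | π , refl = left π , refl
decode (suc m) ηL ηR η | _ , yL , keep .yL | _ , yR , new .yR with decode m yL yR (IsQshPair-unshift (keep yL) (new yR) η)
...   | π , refl = right π , refl
decode (suc m) ηL ηR η | _ , yL , new .yL  | _ , yR , new .yR with decode m yL yR (IsQshPair-unshift (new yL) (new yR) η)
...   | π , refl = both π , refl
decode (suc m) ηL ηR η | _ , yL , keep .yL | _ , yR , keep .yR with covering η zero
...   | inj₁ (i , eq) = ⊥-elim (zero≢map-suc yL i (sym eq))
...   | inj₂ (j , eq) = ⊥-elim (zero≢map-suc yR j (sym eq))

-- Positions are compared through toℕ: the positions of two paths live in Fin types of their own lengths.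
private
  toℕs : Vec (Fin m) n → Vec ℕ n
  toℕs = Vec.map toℕ

  toℕs-unshift : ∀ {m′} (u : Vec (Fin m) n) (v : Vec (Fin m′) n) →
                 toℕs (Vec.map suc u) ≡ toℕs (Vec.map suc v) → toℕs u ≡ toℕs v
  toℕs-unshift []      []      _  = refl
  toℕs-unshift (x ∷ u) (y ∷ v) eq =
    cong₂ _∷_ (ℕ.suc-injective (Vec.∷-injectiveˡ eq)) (toℕs-unshift u v (Vec.∷-injectiveʳ eq))

  zero≢shifted : (v : Vec (Fin m) (suc n)) {w : Vec ℕ n} → 0 ∷ w ≢ toℕs (Vec.map suc v)
  zero≢shifted (x ∷ v) ()

  toℕs-positions-injective : (π π′ : Path p q) → toℕs (leftPositions π) ≡ toℕs (leftPositions π′) →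
                             toℕs (rightPositions π) ≡ toℕs (rightPositions π′) → π ≡ π′
  toℕs-positions-injective end       end        _  _  = refl
  toℕs-positions-injective (left π)  (left π′)  eL eR =
    cong left (toℕs-positions-injective π π′ (toℕs-unshift _ _ (Vec.∷-injectiveʳ eL)) (toℕs-unshift _ _ eR))
  toℕs-positions-injective (right π) (right π′) eL eR =
    cong right (toℕs-positions-injective π π′ (toℕs-unshift _ _ eL) (toℕs-unshift _ _ (Vec.∷-injectiveʳ eR)))
  toℕs-positions-injective (both π)  (both π′)  eL eR =
    cong both (toℕs-positions-injective π π′ (toℕs-unshift _ _ (Vec.∷-injectiveʳ eL)) (toℕs-unshift _ _ (Vec.∷-injectiveʳ eR)))
  toℕs-positions-injective (left π)  (right π′) eL eR = ⊥-elim (zero≢shifted (leftPositions π′) eL)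
  toℕs-positions-injective (left π)  (both π′)  eL eR = ⊥-elim (zero≢shifted (rightPositions π) (sym eR))
  toℕs-positions-injective (right π) (left π′)  eL eR = ⊥-elim (zero≢shifted (leftPositions π) (sym eL))
  toℕs-positions-injective (right π) (both π′)  eL eR = ⊥-elim (zero≢shifted (leftPositions π) (sym eL))
  toℕs-positions-injective (both π)  (left π′)  eL eR = ⊥-elim (zero≢shifted (rightPositions π′) eR)
  toℕs-positions-injective (both π)  (right π′) eL eR = ⊥-elim (zero≢shifted (leftPositions π′) eL)

positions-injective : {π π′ : Path p q} →
  _≡_ {A = Σ ℕ λ m → Vec (Fin m) (p + q)} (length π , positions π) (length π′ , positions π′) → π ≡ π′
positions-injective {p = p} {q = q} {π = π} {π′} eq
  with Vec.++-injective (toℕs (leftPositions π)) (toℕs (leftPositions π′)) toℕs-halves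
  where
  toℕs-halves : toℕs (leftPositions π) Vec.++ toℕs (rightPositions π) ≡ toℕs (leftPositions π′) Vec.++ toℕs (rightPositions π′)
  toℕs-halves = trans (sym (Vec.map-++ toℕ (leftPositions π) _))
                      (trans (cong (λ (e : Σ ℕ λ m → Vec (Fin m) (p + q)) → toℕs (proj₂ e)) eq) (Vec.map-++ toℕ (leftPositions π′) _))
... | eqL , eqR = toℕs-positions-injective π π′ eqL eqR

-- Paths in qsh_φ

-- The conditions of qsh_φ(p,q) that relate the two halves; within one half they hold automatically.
record Respects (fL : Vec (Fin s) p) (fR : Vec (Fin s) q) (ηL : Vec (Fin m) p) (ηR : Vec (Fin m) q) : Set where
  field
    orderˡʳ : ∀ i j → lookup fL i < lookup fR j → lookup ηL i < lookup ηR j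
    orderʳˡ : ∀ i j → lookup fR j < lookup fL i → lookup ηR j < lookup ηL i
    factors : ∀ i j → lookup ηL i ≡ lookup ηR j → lookup fL i ≡ lookup fR j
open Respects

Respects-unshift : ∀ {n₁ n₂} {fL′ : Vec (Fin s) n₁} {fR′ : Vec (Fin s) n₂} {fL : Vec (Fin s) p} {fR : Vec (Fin s) q}
  {xL : Vec (Fin (suc m)) n₁} {xR : Vec (Fin (suc m)) n₂} {yL : Vec (Fin m) p} {yR : Vec (Fin m) q}
  (shL : Shift xL yL) (shR : Shift xR yR) →
  (∀ i → lookup fL′ (embed shL i) ≡ lookup fL i) → (∀ j → lookup fR′ (embed shR j) ≡ lookup fR j) →
  Respects fL′ fR′ xL xR → Respects fL fR yL yR
Respects-unshift shL shR labelsL labelsR r = record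
  { orderˡʳ = λ i j lt → lookup-embed-< shL shR (orderˡʳ r _ _ (subst₂ _<_ (sym (labelsL i)) (sym (labelsR j)) lt))
  ; orderʳˡ = λ i j lt → lookup-embed-< shR shL (orderʳˡ r _ _ (subst₂ _<_ (sym (labelsR j)) (sym (labelsL i)) lt))
  ; factors = λ i j eq → trans (sym (labelsL i))
      (trans (factors r _ _ (trans (lookup-embed shL i) (trans (cong suc eq) (sym (lookup-embed shR j))))) (labelsR j))
  }

module _ {k : Fin s} {fL : Vec (Fin s) p} {fR : Vec (Fin s) q} {P : Vec (Fin m) p} {Q : Vec (Fin m) q} where

  Respects-left : (∀ j → k ≤ lookup fR j) → Respects fL fR P Q →
                  Respects (k ∷ fL) fR (zero ∷ Vec.map Fin.suc P) (Vec.map Fin.suc Q)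
  Respects-left k≤fR r = record
    { orderˡʳ = λ { zero j _ → zero<map-suc Q j ; (suc i) j lt → <-map-suc P Q (orderˡʳ r i j lt) }
    ; orderʳˡ = λ { zero j lt → ⊥-elim (ℕ.<⇒≱ lt (k≤fR j)) ; (suc i) j lt → <-map-suc Q P (orderʳˡ r i j lt) }
    ; factors = λ { zero j eq → ⊥-elim (zero≢map-suc Q j eq) ; (suc i) j eq → factors r i j (≡-map-suc⁻ P Q eq) }
    }

  Respects-right : (∀ i → k ≤ lookup fL i) → Respects fL fR P Q →
                   Respects fL (k ∷ fR) (Vec.map Fin.suc P) (zero ∷ Vec.map Fin.suc Q)
  Respects-right k≤fL r = record
    { orderˡʳ = λ { i zero lt → ⊥-elim (ℕ.<⇒≱ lt (k≤fL i)) ; i (suc j) lt → <-map-suc P Q (orderˡʳ r i j lt) }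
    ; orderʳˡ = λ { i zero _ → zero<map-suc P i ; i (suc j) lt → <-map-suc Q P (orderʳˡ r i j lt) }
    ; factors = λ { i zero eq → ⊥-elim (zero≢map-suc P i (sym eq)) ; i (suc j) eq → factors r i j (≡-map-suc⁻ P Q eq) }
    }

  Respects-both : (∀ i → k ≤ lookup fL i) → (∀ j → k ≤ lookup fR j) → Respects fL fR P Q →
                  Respects (k ∷ fL) (k ∷ fR) (zero ∷ Vec.map Fin.suc P) (zero ∷ Vec.map Fin.suc Q)
  Respects-both k≤fL k≤fR r = record
    { orderˡʳ = λ { zero    zero    lt → ⊥-elim (ℕ.<-irrefl refl lt)
                  ; zero    (suc j) _  → zero<map-suc Q j
                  ; (suc i) zero    lt → ⊥-elim (ℕ.<⇒≱ lt (k≤fL i))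
                  ; (suc i) (suc j) lt → <-map-suc P Q (orderˡʳ r i j lt) }
    ; orderʳˡ = λ { zero    zero    lt → ⊥-elim (ℕ.<-irrefl refl lt)
                  ; (suc i) zero    _  → zero<map-suc P i
                  ; zero    (suc j) lt → ⊥-elim (ℕ.<⇒≱ lt (k≤fR j))
                  ; (suc i) (suc j) lt → <-map-suc Q P (orderʳˡ r i j lt) }
    ; factors = λ { zero    zero    _  → refl
                  ; zero    (suc j) eq → ⊥-elim (zero≢map-suc Q j eq)
                  ; (suc i) zero    eq → ⊥-elim (zero≢map-suc P i (sym eq))
                  ; (suc i) (suc j) eq → factors r i j (≡-map-suc⁻ P Q eq) }
    }

private
  ∈-when⁻ : ∀ {ℓ} {P : Set ℓ} {x : A} {xs} (P? : Dec P) → x ∈ when P? xs → P × x ∈ xs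
  ∈-when⁻ (yes p) x∈xs = p , x∈xs

  ∈-when⁺ : ∀ {ℓ} {P : Set ℓ} {x : A} {xs} (P? : Dec P) → P → x ∈ xs → x ∈ when P? xs
  ∈-when⁺ (yes _) _ x∈xs = x∈xs
  ∈-when⁺ (no ¬p) p _    = ⊥-elim (¬p p)

  ∈-when-map : ∀ {ℓ} {P : Set ℓ} {f : A → B} {y xs} (P? : Dec P) → y ∈ when P? (List.map f xs) → ∃ λ x → y ≡ f x
  ∈-when-map {f = f} P? y∈ with ∈-map⁻ f (proj₂ (∈-when⁻ P? y∈))
  ... | x , _ , eq = x , eq

  Unique-when : ∀ {ℓ} {P : Set ℓ} {xs : List A} (P? : Dec P) → Unique xs → Unique (when P? xs)
  Unique-when (yes _) u = u
  Unique-when (no _)  _ = []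

  ∈-map-injective⁻ : ∀ {f : A → B} {x xs} → (∀ {y z} → f y ≡ f z → y ≡ z) → f x ∈ List.map f xs → x ∈ xs
  ∈-map-injective⁻ f-injective fx∈ with ∈-map⁻ _ fx∈
  ... | _ , x∈ , eq rewrite f-injective eq = x∈

HeadBound : Fin s → Vec (Fin s) n → Set
HeadBound k []      = ⊤
HeadBound k (l ∷ _) = k ≤ l

HeadBound⇒lowerBound : {k : Fin s} {v : Vec (Fin s) n} → Nondecreasing v → HeadBound k v → ∀ j → k ≤ lookup v j
HeadBound⇒lowerBound {v = l ∷ v} nd k≤l j = ℕ.≤-trans k≤l (nd zero j z≤n)

lowerBound⇒HeadBound : {k : Fin s} (v : Vec (Fin s) n) → (∀ j → k ≤ lookup v j) → HeadBound k v
lowerBound⇒HeadBound []      _   = tt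
lowerBound⇒HeadBound (l ∷ v) k≤v = k≤v zero

module _ {k : Fin s} where
  private
    left-injective : ∀ {π π′ : Path p q} → left π ≡ left π′ → π ≡ π′
    left-injective refl = refl
    right-injective : ∀ {π π′ : Path p q} → right π ≡ right π′ → π ≡ π′
    right-injective refl = refl
    both-injective : ∀ {π π′ : Path p q} → both π ≡ both π′ → π ≡ π′
    both-injective refl = refl

  qshφ-left⁻ : ∀ {fL : Vec (Fin s) p} (fR : Vec (Fin s) q) {π} →
               left π ∈ qshφ (k ∷ fL) fR → HeadBound k fR × π ∈ qshφ fL fR
  qshφ-left⁻ []       π∈ = tt , ∈-map-injective⁻ left-injective π∈
  qshφ-left⁻ (l ∷ fR) π∈ with ∈-++⁻ (when (k ≤? l) _) π∈
  ... | inj₁ π∈₁ = map₂ (∈-map-injective⁻ left-injective) (∈-when⁻ (k ≤? l) π∈₁)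
  ... | inj₂ π∈₂ with ∈-++⁻ (when (l ≤? k) _) π∈₂
  ...   | inj₁ π∈₃ with ∈-when-map (l ≤? k) π∈₃
  ...     | _ , ()
  qshφ-left⁻ (l ∷ fR) π∈ | inj₂ π∈₂ | inj₂ π∈₃ with ∈-when-map (k ≟ l) π∈₃
  ...     | _ , ()

  qshφ-right⁻ : ∀ (fL : Vec (Fin s) p) {fR : Vec (Fin s) q} {π} →
                right π ∈ qshφ fL (k ∷ fR) → HeadBound k fL × π ∈ qshφ fL fR
  qshφ-right⁻ []       π∈ = tt , ∈-map-injective⁻ right-injective π∈
  qshφ-right⁻ (l ∷ fL) π∈ with ∈-++⁻ (when (l ≤? k) _) π∈
  ... | inj₁ π∈₁ with ∈-when-map (l ≤? k) π∈₁
  ...   | _ , ()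
  qshφ-right⁻ (l ∷ fL) π∈ | inj₂ π∈₂ with ∈-++⁻ (when (k ≤? l) _) π∈₂
  ...   | inj₁ π∈₃ = map₂ (∈-map-injective⁻ right-injective) (∈-when⁻ (k ≤? l) π∈₃)
  ...   | inj₂ π∈₃ with ∈-when-map (l ≟ k) π∈₃
  ...     | _ , ()

  qshφ-both⁻ : ∀ {l} (fL : Vec (Fin s) p) (fR : Vec (Fin s) q) {π} →
               both π ∈ qshφ (k ∷ fL) (l ∷ fR) → k ≡ l × π ∈ qshφ fL fR
  qshφ-both⁻ {l = l} fL fR π∈ with ∈-++⁻ (when (k ≤? l) _) π∈
  ... | inj₁ π∈₁ with ∈-when-map (k ≤? l) π∈₁
  ...   | _ , ()
  qshφ-both⁻ {l = l} fL fR π∈ | inj₂ π∈₂ with ∈-++⁻ (when (l ≤? k) _) π∈₂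
  ...   | inj₁ π∈₃ with ∈-when-map (l ≤? k) π∈₃
  ...     | _ , ()
  qshφ-both⁻ {l = l} fL fR π∈ | inj₂ π∈₂ | inj₂ π∈₃ = map₂ (∈-map-injective⁻ both-injective) (∈-when⁻ (k ≟ l) π∈₃)

  qshφ-left⁺ : ∀ {fL : Vec (Fin s) p} (fR : Vec (Fin s) q) {π} →
               HeadBound k fR → π ∈ qshφ fL fR → left π ∈ qshφ (k ∷ fL) fR
  qshφ-left⁺ []       _   π∈ = ∈-map⁺ left π∈
  qshφ-left⁺ (l ∷ fR) k≤l π∈ = ∈-++⁺ˡ (∈-when⁺ (k ≤? l) k≤l (∈-map⁺ left π∈))

  qshφ-right⁺ : ∀ (fL : Vec (Fin s) p) {fR : Vec (Fin s) q} {π} →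
                HeadBound k fL → π ∈ qshφ fL fR → right π ∈ qshφ fL (k ∷ fR)
  qshφ-right⁺ []       _   π∈ = ∈-map⁺ right π∈
  qshφ-right⁺ (l ∷ fL) k≤l π∈ = ∈-++⁺ʳ (when (l ≤? k) _) (∈-++⁺ˡ (∈-when⁺ (k ≤? l) k≤l (∈-map⁺ right π∈)))

  qshφ-both⁺ : ∀ {l} (fL : Vec (Fin s) p) (fR : Vec (Fin s) q) {π} →
               k ≡ l → π ∈ qshφ fL fR → both π ∈ qshφ (k ∷ fL) (l ∷ fR)
  qshφ-both⁺ {l = l} fL fR k≡l π∈ =
    ∈-++⁺ʳ (when (k ≤? l) _) (∈-++⁺ʳ (when (l ≤? k) _) (∈-when⁺ (k ≟ l) k≡l (∈-map⁺ both π∈)))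

qshφ-unique : (fL : Vec (Fin s) p) (fR : Vec (Fin s) q) → Unique (qshφ fL fR)
qshφ-unique []       []       = [] ∷ []
qshφ-unique (k ∷ fL) []       = Unique.map⁺ (λ { refl → refl }) (qshφ-unique fL [])
qshφ-unique []       (l ∷ fR) = Unique.map⁺ (λ { refl → refl }) (qshφ-unique [] fR)
qshφ-unique (k ∷ fL) (l ∷ fR) =
  Unique.++⁺ (Unique-when (k ≤? l) (Unique.map⁺ (λ { refl → refl }) (qshφ-unique fL (l ∷ fR))))
    (Unique.++⁺ (Unique-when (l ≤? k) (Unique.map⁺ (λ { refl → refl }) (qshφ-unique (k ∷ fL) fR)))
                (Unique-when (k ≟ l) (Unique.map⁺ (λ { refl → refl }) (qshφ-unique fL fR)))
                right∉both)
    left∉rest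
  where
  right∉both : ∀ {π} → ¬ (π ∈ when (l ≤? k) (List.map right (qshφ (k ∷ fL) fR)) × π ∈ when (k ≟ l) (List.map both (qshφ fL fR)))
  right∉both (π∈₁ , π∈₂) with ∈-when-map (l ≤? k) π∈₁ | ∈-when-map (k ≟ l) π∈₂
  ... | _ , refl | _ , ()
  left∉rest : ∀ {π} → ¬ (π ∈ when (k ≤? l) (List.map left (qshφ fL (l ∷ fR)))
                         × π ∈ when (l ≤? k) (List.map right (qshφ (k ∷ fL) fR)) ++ when (k ≟ l) (List.map both (qshφ fL fR)))
  left∉rest (π∈₁ , π∈₂) with ∈-when-map (k ≤? l) π∈₁ | ∈-++⁻ (when (l ≤? k) _) π∈₂
  ... | _ , refl | inj₁ π∈₃ with ∈-when-map (l ≤? k) π∈₃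
  ...   | _ , ()
  left∉rest (π∈₁ , π∈₂) | _ , refl | inj₂ π∈₃ with ∈-when-map (k ≟ l) π∈₃
  ...   | _ , ()

qshφ-respects : (π : Path p q) (fL : Vec (Fin s) p) (fR : Vec (Fin s) q) → Nondecreasing fL → Nondecreasing fR →
                π ∈ qshφ fL fR → Respects fL fR (leftPositions π) (rightPositions π)
qshφ-respects end [] [] _ _ _ = record { orderˡʳ = λ () ; orderʳˡ = λ () ; factors = λ () }
qshφ-respects (left π) (k ∷ fL) fR ndL ndR π∈ with qshφ-left⁻ fR π∈
... | k≤fR , π∈′ = Respects-left (HeadBound⇒lowerBound ndR k≤fR) (qshφ-respects π fL fR (Nondecreasing-tail ndL) ndR π∈′)
qshφ-respects (right π) fL (l ∷ fR) ndL ndR π∈ with qshφ-right⁻ fL π∈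
... | l≤fL , π∈′ = Respects-right (HeadBound⇒lowerBound ndL l≤fL) (qshφ-respects π fL fR ndL (Nondecreasing-tail ndR) π∈′)
qshφ-respects (both π) (k ∷ fL) (l ∷ fR) ndL ndR π∈ with qshφ-both⁻ {k = k} fL fR π∈
... | refl , π∈′ = Respects-both (λ i → ndL zero (suc i) z≤n) (λ j → ndR zero (suc j) z≤n)
                     (qshφ-respects π fL fR (Nondecreasing-tail ndL) (Nondecreasing-tail ndR) π∈′)

respects-qshφ : (π : Path p q) (fL : Vec (Fin s) p) (fR : Vec (Fin s) q) →
                Respects fL fR (leftPositions π) (rightPositions π) → π ∈ qshφ fL fR
respects-qshφ end [] [] _ = here refl
respects-qshφ (left π) (k ∷ fL) fR r =
  qshφ-left⁺ fR (lowerBound⇒HeadBound fR (λ j → ℕ.≮⇒≥ (λ lt → ℕ.n≮0 (orderʳˡ r zero j lt))))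
    (respects-qshφ π fL fR (Respects-unshift (new _) (keep _) (λ _ → refl) (λ _ → refl) r))
respects-qshφ (right π) fL (l ∷ fR) r =
  qshφ-right⁺ fL (lowerBound⇒HeadBound fL (λ i → ℕ.≮⇒≥ (λ lt → ℕ.n≮0 (orderˡʳ r i zero lt))))
    (respects-qshφ π fL fR (Respects-unshift (keep _) (new _) (λ _ → refl) (λ _ → refl) r))
respects-qshφ (both π) (k ∷ fL) (l ∷ fR) r =
  qshφ-both⁺ fL fR (factors r zero zero refl)
    (respects-qshφ π fL fR (Respects-unshift (new _) (new _) (λ _ → refl) (λ _ → refl) r))

private
  map-lookup-∷-suc : (x : A) (L : Vec A m) (P : Vec (Fin m) n) →
                     Vec.map (lookup (x ∷ L)) (Vec.map Fin.suc P) ≡ Vec.map (lookup L) P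
  map-lookup-∷-suc x L P = sym (Vec.map-∘ (lookup (x ∷ L)) Fin.suc P)

qshφ-labels : (π : Path p q) (fL : Vec (Fin s) p) (fR : Vec (Fin s) q) → π ∈ qshφ fL fR →
  Vec.map (lookup (labels π fL fR)) (leftPositions π) ≡ fL × Vec.map (lookup (labels π fL fR)) (rightPositions π) ≡ fR
qshφ-labels end [] [] _ = refl , refl
qshφ-labels (left π) (k ∷ fL) fR π∈ with qshφ-labels π fL fR (proj₂ (qshφ-left⁻ fR π∈))
... | eqL , eqR = cong (k ∷_) (trans (map-lookup-∷-suc k _ (leftPositions π)) eqL) ,
                  trans (map-lookup-∷-suc k _ (rightPositions π)) eqR
qshφ-labels (right π) fL (l ∷ fR) π∈ with qshφ-labels π fL fR (proj₂ (qshφ-right⁻ fL π∈))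
... | eqL , eqR = trans (map-lookup-∷-suc l _ (leftPositions π)) eqL ,
                  cong (l ∷_) (trans (map-lookup-∷-suc l _ (rightPositions π)) eqR)
qshφ-labels (both π) (k ∷ fL) (l ∷ fR) π∈ with qshφ-both⁻ {k = k} fL fR π∈
... | refl , π∈′ with qshφ-labels π fL fR π∈′
...   | eqL , eqR = cong (k ∷_) (trans (map-lookup-∷-suc k _ (leftPositions π)) eqL) ,
                    cong (k ∷_) (trans (map-lookup-∷-suc k _ (rightPositions π)) eqR)

-- The two halves of Fin (p + q)

data Half (p q : ℕ) : Fin (p + q) → Set where
  inˡ : (i : Fin p) → Half p q (i ↑ˡ q)
  inʳ : (j : Fin q) → Half p q (p ↑ʳ j)

half : ∀ p q (i : Fin (p + q)) → Half p q i
half zero    q i       = inʳ i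
half (suc p) q zero    = inˡ zero
half (suc p) q (suc i) with half p q i
... | inˡ i′ = inˡ (suc i′)
... | inʳ j  = inʳ j

↑ˡ<p : ∀ q (i : Fin p) → toℕ (i ↑ˡ q) ℕ.< p
↑ˡ<p {p} q i = subst (ℕ._< p) (sym (toℕ-↑ˡ i q)) (toℕ<n i)

p≤↑ʳ : ∀ p (j : Fin q) → p ℕ.≤ toℕ (p ↑ʳ j)
p≤↑ʳ p j = subst (p ℕ.≤_) (sym (toℕ-↑ʳ p j)) (ℕ.m≤m+n p _)

↑ˡ-≤ : ∀ q {i j : Fin p} → i ≤ j → i ↑ˡ q ≤ j ↑ˡ q
↑ˡ-≤ q {i} {j} = subst₂ ℕ._≤_ (sym (toℕ-↑ˡ i q)) (sym (toℕ-↑ˡ j q))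

↑ˡ-< : ∀ q {i j : Fin p} → i < j → i ↑ˡ q < j ↑ˡ q
↑ˡ-< q {i} {j} = subst₂ ℕ._<_ (sym (toℕ-↑ˡ i q)) (sym (toℕ-↑ˡ j q))

↑ʳ-≤ : ∀ p {i j : Fin q} → i ≤ j → p ↑ʳ i ≤ p ↑ʳ j
↑ʳ-≤ p {i} {j} i≤j = subst₂ ℕ._≤_ (sym (toℕ-↑ʳ p i)) (sym (toℕ-↑ʳ p j)) (ℕ.+-monoʳ-≤ p i≤j)

↑ʳ-< : ∀ p {i j : Fin q} → i < j → p ↑ʳ i < p ↑ʳ j
↑ʳ-< p {i} {j} i<j = subst₂ ℕ._<_ (sym (toℕ-↑ʳ p i)) (sym (toℕ-↑ʳ p j)) (ℕ.+-monoʳ-< p i<j)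

sorted-order : {f : Vec (Fin s) p} {η : Vec (Fin m) p} → Nondecreasing f → StrictlyIncreasing η →
               ∀ i j → lookup f i < lookup f j → lookup η i < lookup η j
sorted-order nd increasing i j fi<fj with <-cmp i j
... | tri< i<j _ _  = increasing i j i<j
... | tri≈ _ refl _ = ⊥-elim (ℕ.<-irrefl refl fi<fj)
... | tri> _ _ j<i  = ⊥-elim (ℕ.<⇒≱ fi<fj (nd j i (ℕ.<⇒≤ j<i)))

module _ {fL : Vec (Fin s) p} {fR : Vec (Fin s) q} {ηL : Vec (Fin m) p} {ηR : Vec (Fin m) q} where
  private
    ηˡ : ∀ i → lookup (ηL Vec.++ ηR) (i ↑ˡ q) ≡ lookup ηL i
    ηˡ = Vec.lookup-++ˡ ηL ηR
    ηʳ : ∀ j → lookup (ηL Vec.++ ηR) (p ↑ʳ j) ≡ lookup ηR j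
    ηʳ = Vec.lookup-++ʳ ηL ηR
    φˡ : ∀ i → lookup (fL Vec.++ fR) (i ↑ˡ q) ≡ lookup fL i
    φˡ = Vec.lookup-++ˡ fL fR
    φʳ : ∀ j → lookup (fL Vec.++ fR) (p ↑ʳ j) ≡ lookup fR j
    φʳ = Vec.lookup-++ʳ fL fR

  InQshφ⇒halves : InQshφ p (fL Vec.++ fR) (ηL Vec.++ ηR) → IsQshPair ηL ηR × Respects fL fR ηL ηR
  InQshφ⇒halves ((surjective , incˡ , incʳ) , order , τ , φ≡τη) = isQshPair , respects
    where
    cover : ∀ k → (∃ λ i → lookup ηL i ≡ k) ⊎ (∃ λ j → lookup ηR j ≡ k)
    cover k with surjective k
    ... | a , eq with half p q a
    ...   | inˡ i = inj₁ (i , trans (sym (ηˡ i)) eq)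
    ...   | inʳ j = inj₂ (j , trans (sym (ηʳ j)) eq)
    isQshPair : IsQshPair ηL ηR
    isQshPair = record
      { increasingˡ = λ i j i<j → subst₂ _<_ (ηˡ i) (ηˡ j) (incˡ _ _ (↑ˡ-< q i<j) (↑ˡ<p q j))
      ; increasingʳ = λ i j i<j → subst₂ _<_ (ηʳ i) (ηʳ j) (incʳ _ _ (↑ʳ-< p i<j) (p≤↑ʳ p i))
      ; covering    = cover
      }
    respects : Respects fL fR ηL ηR
    respects = record
      { orderˡʳ = λ i j lt → subst₂ _<_ (ηˡ i) (ηʳ j) (order _ _ (subst₂ _<_ (sym (φˡ i)) (sym (φʳ j)) lt))
      ; orderʳˡ = λ i j lt → subst₂ _<_ (ηʳ j) (ηˡ i) (order _ _ (subst₂ _<_ (sym (φʳ j)) (sym (φˡ i)) lt))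
      ; factors = λ i j eq → begin
          lookup fL i                        ≡⟨ φˡ i ⟨
          lookup (fL Vec.++ fR) (i ↑ˡ q)     ≡⟨ φ≡τη (i ↑ˡ q) ⟩
          τ (lookup (ηL Vec.++ ηR) (i ↑ˡ q)) ≡⟨ cong τ (trans (ηˡ i) (trans eq (sym (ηʳ j)))) ⟩
          τ (lookup (ηL Vec.++ ηR) (p ↑ʳ j)) ≡⟨ φ≡τη (p ↑ʳ j) ⟨
          lookup (fL Vec.++ fR) (p ↑ʳ j)     ≡⟨ φʳ j ⟩
          lookup fR j                        ∎
      }
      where open ≡-Reasoning

  halves⇒InQshφ : IsQshPair ηL ηR → Respects fL fR ηL ηR → Nondecreasing fL → Nondecreasing fR →
                  (τ : Fin m → Fin s) → Vec.map τ ηL ≡ fL → Vec.map τ ηR ≡ fR → InQshφ p (fL Vec.++ fR) (ηL Vec.++ ηR)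
  halves⇒InQshφ η r ndL ndR τ τηL≡fL τηR≡fR = (surjective , left-increasing , right-increasing) , order , τ , factorisation
    where
    open IsQshPair η using () renaming (covering to cover; increasingˡ to incˡ; increasingʳ to incʳ)
    surjective : Surjective (ηL Vec.++ ηR)
    surjective k with cover k
    ... | inj₁ (i , eq) = i ↑ˡ q , trans (ηˡ i) eq
    ... | inj₂ (j , eq) = p ↑ʳ j , trans (ηʳ j) eq
    ↑ʳ≮↑ˡ : ∀ i j → toℕ (p ↑ʳ j) ℕ.< toℕ (i ↑ˡ q) → {X : Set} → X
    ↑ʳ≮↑ˡ i j lt = ⊥-elim (ℕ.<⇒≱ (ℕ.<-≤-trans lt (ℕ.<⇒≤ (↑ˡ<p q i))) (p≤↑ʳ p j))
    left-increasing : ∀ a b → a < b → toℕ b ℕ.< p → lookup (ηL Vec.++ ηR) a < lookup (ηL Vec.++ ηR) b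
    left-increasing a b a<b b<p with half p q a | half p q b
    ... | inˡ i | inˡ j = subst₂ _<_ (sym (ηˡ i)) (sym (ηˡ j)) (incˡ i j (subst₂ ℕ._<_ (toℕ-↑ˡ i q) (toℕ-↑ˡ j q) a<b))
    ... | _     | inʳ j = ⊥-elim (ℕ.<⇒≱ b<p (p≤↑ʳ p j))
    ... | inʳ i | inˡ j = ↑ʳ≮↑ˡ j i a<b
    right-increasing : ∀ a b → a < b → p ℕ.≤ toℕ a → lookup (ηL Vec.++ ηR) a < lookup (ηL Vec.++ ηR) b
    right-increasing a b a<b p≤a with half p q a | half p q b
    ... | inˡ i | _     = ⊥-elim (ℕ.<⇒≱ (↑ˡ<p q i) p≤a)
    ... | inʳ i | inˡ j = ↑ʳ≮↑ˡ j i a<b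
    ... | inʳ i | inʳ j = subst₂ _<_ (sym (ηʳ i)) (sym (ηʳ j))
                            (incʳ i j (ℕ.+-cancelˡ-< p _ _ (subst₂ ℕ._<_ (toℕ-↑ʳ p i) (toℕ-↑ʳ p j) a<b)))
    order : ∀ a b → lookup (fL Vec.++ fR) a < lookup (fL Vec.++ fR) b → lookup (ηL Vec.++ ηR) a < lookup (ηL Vec.++ ηR) b
    order a b lt with half p q a | half p q b
    ... | inˡ i | inˡ j = subst₂ _<_ (sym (ηˡ i)) (sym (ηˡ j))
                            (sorted-order {f = fL} {η = ηL} ndL incˡ i j (subst₂ _<_ (φˡ i) (φˡ j) lt))
    ... | inˡ i | inʳ j = subst₂ _<_ (sym (ηˡ i)) (sym (ηʳ j)) (orderˡʳ r i j (subst₂ _<_ (φˡ i) (φʳ j) lt))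
    ... | inʳ j | inˡ i = subst₂ _<_ (sym (ηʳ j)) (sym (ηˡ i)) (orderʳˡ r i j (subst₂ _<_ (φʳ j) (φˡ i) lt))
    ... | inʳ i | inʳ j = subst₂ _<_ (sym (ηʳ i)) (sym (ηʳ j))
                            (sorted-order {f = fR} {η = ηR} ndR incʳ i j (subst₂ _<_ (φʳ i) (φʳ j) lt))
    factorisation : ∀ a → lookup (fL Vec.++ fR) a ≡ τ (lookup (ηL Vec.++ ηR) a)
    factorisation a with half p q a
    ... | inˡ i = trans (φˡ i) (trans (cong (λ v → lookup v i) (sym τηL≡fL)) (trans (Vec.lookup-map i τ ηL) (cong τ (sym (ηˡ i)))))
    ... | inʳ j = trans (φʳ j) (trans (cong (λ v → lookup v j) (sym τηR≡fR)) (trans (Vec.lookup-map j τ ηR) (cong τ (sym (ηʳ j)))))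

-- Enumerations of qsh_φ

factorisation-unique : {φ : Vec (Fin s) n} {η : Vec (Fin m) n} {τ τ′ : Vec (Fin s) m} → Surjective η →
  (∀ j → lookup φ j ≡ lookup τ (lookup η j)) → (∀ j → lookup φ j ≡ lookup τ′ (lookup η j)) → τ ≡ τ′
factorisation-unique {τ = τ} {τ′} surjective φ≡τη φ≡τ′η =
  trans (sym (Vec.tabulate∘lookup τ)) (trans (Vec.tabulate-cong τ≗τ′) (Vec.tabulate∘lookup τ′))
  where
  τ≗τ′ : ∀ k → lookup τ k ≡ lookup τ′ k
  τ≗τ′ k with surjective k
  ... | j , refl = trans (sym (φ≡τη j)) (φ≡τ′η j)

entry : Vec (Fin s) p → Vec (Fin s) q → Path p q → QEntry (p + q) s
entry fL fR π = length π , positions π , labels π fL fR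

module _ (fL : Vec (Fin s) p) (fR : Vec (Fin s) q) (ndL : Nondecreasing fL) (ndR : Nondecreasing fR) where

  qshφ-InQshφ : ∀ {π} → π ∈ qshφ fL fR → InQshφ p (fL Vec.++ fR) (positions π)
  qshφ-InQshφ {π} π∈ with qshφ-labels π fL fR π∈
  ... | τηL≡fL , τηR≡fR =
    halves⇒InQshφ (positions-isQshPair π) (qshφ-respects π fL fR ndL ndR π∈) ndL ndR (lookup (labels π fL fR)) τηL≡fL τηR≡fR

  private
    labels-unique : ∀ {π τ} → π ∈ qshφ fL fR → InQshφ p (fL Vec.++ fR) (positions π) →
                    (∀ j → lookup (fL Vec.++ fR) j ≡ lookup τ (lookup (positions π) j)) → τ ≡ labels π fL fR
    labels-unique π∈ ((surjective , _) , _) φ≡τη =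
      factorisation-unique {φ = fL Vec.++ fR} {η = positions _} surjective φ≡τη (proj₂ (proj₂ (proj₂ (qshφ-InQshφ π∈))))

  enumeration↭entries : (E : List (QEntry (p + q) s)) → IsEnumeration p (fL Vec.++ fR) E →
                        E ↭ List.map (entry fL fR) (qshφ fL fR)
  enumeration↭entries E (valid , unique , complete) =
    ∼bag⇒↭ (unique∧set⇒bag (Unique.map⁻ unique) (Unique.map⁺ (positions-injective ∘ cong entryη) (qshφ-unique fL fR))
                            (mk⇔ E⊆entries entries⊆E))
    where
    E⊆entries : ∀ {e} → e ∈ E → e ∈ List.map (entry fL fR) (qshφ fL fR)
    E⊆entries {m , η , τ} e∈E with All.lookup valid e∈E
    ... | inQshφ , _ , _ , φ≡τη with Vec.splitAt p η
    ...   | ηL , ηR , refl with InQshφ⇒halves inQshφ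
    ...     | isQshPair , respects with decode m ηL ηR isQshPair
    ...       | π , refl = subst (λ τ → (_ , _ , τ) ∈ List.map (entry fL fR) (qshφ fL fR))
                                 (sym (labels-unique π∈ inQshφ φ≡τη)) (∈-map⁺ (entry fL fR) π∈)
      where π∈ = respects-qshφ π fL fR respects

    entries⊆E : ∀ {e} → e ∈ List.map (entry fL fR) (qshφ fL fR) → e ∈ E
    entries⊆E e∈ with ∈-map⁻ (entry fL fR) e∈
    ... | π , π∈ , refl with ∈-map⁻ entryη (complete (length π) (positions π) (qshφ-InQshφ π∈))
    ...   | (_ , _ , τ) , e∈E , refl with All.lookup valid e∈E
    ...     | inQshφ , _ , _ , φ≡τη = subst (λ τ → (_ , _ , τ) ∈ E) (labels-unique π∈ inQshφ φ≡τη) e∈E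

-- Blocks of a sorted labelling

adjacentEqualities : Vec (Fin s) n → List Bool
adjacentEqualities (k ∷ l ∷ μ) = does (k ≟ l) ∷ adjacentEqualities (l ∷ μ)
adjacentEqualities _           = []

prependToFirst : A → List (List A) → List (List A)
prependToFirst x []         = [ [ x ] ]
prependToFirst x (xs ∷ xss) = (x ∷ xs) ∷ xss

-- The Boolean list says whether consecutive letters share a block.
blocks : List A → List Bool → List (List A)
blocks []           _            = []
blocks (x ∷ [])     _            = [ [ x ] ]
blocks (x ∷ y ∷ xs) (true ∷ bs)  = prependToFirst x (blocks (y ∷ xs) bs)
blocks (x ∷ y ∷ xs) (false ∷ bs) = [ x ] ∷ blocks (y ∷ xs) bs
blocks (x ∷ y ∷ xs) []           = [ x ∷ y ∷ xs ]

adjacentEqualities-map-suc : (μ : Vec (Fin s) n) → adjacentEqualities (Vec.map suc μ) ≡ adjacentEqualities μ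
adjacentEqualities-map-suc []          = refl
adjacentEqualities-map-suc (k ∷ [])    = refl
adjacentEqualities-map-suc (k ∷ l ∷ μ) = cong (does (k ≟ l) ∷_) (adjacentEqualities-map-suc (l ∷ μ))

SameEqualities : ∀ {t} → Vec (Fin s) n → Vec (Fin t) n → Set
SameEqualities μ ν = (∀ i j → lookup μ i ≡ lookup μ j → lookup ν i ≡ lookup ν j)
                   × (∀ i j → lookup ν i ≡ lookup ν j → lookup μ i ≡ lookup μ j)

adjacentEqualities-cong : ∀ {t} (μ : Vec (Fin s) n) (ν : Vec (Fin t) n) →
                          SameEqualities μ ν → adjacentEqualities μ ≡ adjacentEqualities ν
adjacentEqualities-cong []          []            _           = refl
adjacentEqualities-cong (k ∷ [])    (k′ ∷ [])     _           = refl
adjacentEqualities-cong (k ∷ l ∷ μ) (k′ ∷ l′ ∷ ν) (μ⇒ν , ν⇒μ) =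
  cong₂ _∷_ (does-⇔ (mk⇔ (μ⇒ν zero (suc zero)) (ν⇒μ zero (suc zero))) (k ≟ l) (k′ ≟ l′))
            (adjacentEqualities-cong (l ∷ μ) (l′ ∷ ν) ((λ i j → μ⇒ν (suc i) (suc j)) , (λ i j → ν⇒μ (suc i) (suc j))))

blocks-zeroBlock : (x : A) (w₀ : Vec A a₀) (w : Vec A n) (μ : Vec (Fin s) n) →
  blocks (x ∷ toList (w₀ Vec.++ w)) (adjacentEqualities (zero ∷ replicate a₀ zero Vec.++ Vec.map suc μ))
    ≡ (x ∷ toList w₀) ∷ blocks (toList w) (adjacentEqualities μ)
blocks-zeroBlock x []       []      []      = refl
blocks-zeroBlock x []       (y ∷ w) (l ∷ μ) = cong ([ x ] ∷_) (cong (blocks (y ∷ toList w)) (adjacentEqualities-map-suc (l ∷ μ)))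
blocks-zeroBlock x (y ∷ w₀) w       μ       = cong (prependToFirst x) (blocks-zeroBlock y w₀ w μ)

-- Formal sums up to permutation

concatMap⁺ : {f g : A → List B} → (∀ x → f x ↭ g x) → ∀ xs → concatMap f xs ↭ concatMap g xs
concatMap⁺ f↭g []       = ↭-refl
concatMap⁺ f↭g (x ∷ xs) = ++⁺ (f↭g x) (concatMap⁺ f↭g xs)

concatMap-↭ : (f : A → List B) {xs ys : List A} → xs ↭ ys → concatMap f xs ↭ concatMap f ys
concatMap-↭ f ↭.refl         = ↭-refl
concatMap-↭ f (↭.prep x p)   = ++⁺ˡ (f x) (concatMap-↭ f p)
concatMap-↭ f (↭.swap x y p) = ↭-trans (shifts (f x) (f y)) (++⁺ˡ (f y) (++⁺ˡ (f x) (concatMap-↭ f p)))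
concatMap-↭ f (↭.trans p q)  = ↭-trans (concatMap-↭ f p) (concatMap-↭ f q)

concatMap-split : (f g : A → List B) (xs : List A) → concatMap (λ x → f x ++ g x) xs ↭ concatMap f xs ++ concatMap g xs
concatMap-split f g []       = ↭-refl
concatMap-split f g (x ∷ xs) = begin
  (f x ++ g x) ++ concatMap (λ x → f x ++ g x) xs  ↭⟨ ++⁺ˡ (f x ++ g x) (concatMap-split f g xs) ⟩
  (f x ++ g x) ++ (concatMap f xs ++ concatMap g xs) ≡⟨ List.++-assoc (f x) (g x) _ ⟩
  f x ++ g x ++ concatMap f xs ++ concatMap g xs    ↭⟨ ++⁺ˡ (f x) (shifts (g x) (concatMap f xs)) ⟩
  f x ++ concatMap f xs ++ g x ++ concatMap g xs    ≡⟨ List.++-assoc (f x) _ _ ⟨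
  (f x ++ concatMap f xs) ++ g x ++ concatMap g xs  ∎
  where open PermutationReasoning

concatMap-swap : ∀ {c} {C : Set c} (g : A → B → List C) xs ys →
  concatMap (λ x → concatMap (g x) ys) xs ↭ concatMap (λ y → concatMap (λ x → g x y) xs) ys
concatMap-swap g []       ys = ↭-reflexive (sym (concatMap-[] ys))
  where
  concatMap-[] : ∀ {c} {C : Set c} (ys : List B) → concatMap (λ _ → []) ys ≡ List.[] {A = C}
  concatMap-[] []       = refl
  concatMap-[] (y ∷ ys) = concatMap-[] ys
concatMap-swap g (x ∷ xs) ys = begin
  concatMap (g x) ys ++ concatMap (λ x → concatMap (g x) ys) xs   ↭⟨ ++⁺ˡ _ (concatMap-swap g xs ys) ⟩
  concatMap (g x) ys ++ concatMap (λ y → concatMap (λ x → g x y) xs) ys ↭⟨ concatMap-split (g x) _ ys ⟨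
  concatMap (λ y → g x y ++ concatMap (λ x → g x y) xs) ys       ∎
  where open PermutationReasoning

concatMap-concatMap : ∀ {c} {C : Set c} (f : B → List C) (g : A → List B) xs →
                      concatMap f (concatMap g xs) ≡ concatMap (concatMap f ∘ g) xs
concatMap-concatMap f g []       = refl
concatMap-concatMap f g (x ∷ xs) =
  trans (List.concatMap-++ f (g x) (concatMap g xs)) (cong (concatMap f (g x) ++_) (concatMap-concatMap f g xs))

concatMap-split₃ : (f g h : A → List B) (xs : List A) →
  concatMap (λ x → f x ++ g x ++ h x) xs ↭ concatMap f xs ++ concatMap g xs ++ concatMap h xs
concatMap-split₃ f g h xs = ↭-trans (concatMap-split f (λ x → g x ++ h x) xs) (++⁺ˡ (concatMap f xs) (concatMap-split g h xs))

map-concatMap : (g : B → B) (h : A → List B) (xs : List A) →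
  List.map g (concatMap h xs) ≡ concatMap (λ x → List.map g (h x)) xs
map-concatMap g h xs = sym (trans (cong List.concat (List.map-∘ xs)) (List.concat-map (List.map h xs)))

module QuasiShuffleAlgebra {a} {Ω : Set a} (_⊕_ : Ω → Ω → Ω)
                           (⊕-isCommutativeSemigroup : IsCommutativeSemigroup _≡_ _⊕_) where

  open QuasiShuffle _⊕_ using (qsh; _⧢_; ⧢-all)
  open MergedWords _⊕_ using (qsh-[]ʳ)
  open IsCommutativeSemigroup ⊕-isCommutativeSemigroup using () renaming (comm to ⊕-comm; assoc to ⊕-assoc)
  module ++-Solver = Algebra.Solver.CommutativeMonoid (++-commutativeMonoid {A = Word Ω})

  infixr 6 _·_
  _·_ : Ω → FormalSum Ω → FormalSum Ω
  x · L = List.map (x ∷_) L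

  ·-cong : ∀ {x y L M} → x ≡ y → L ↭ M → x · L ↭ y · M
  ·-cong refl = map⁺ _

  qsh-comm : ∀ u v → qsh u v ↭ qsh v u
  qsh-comm []      []      = ↭-refl
  qsh-comm []      (y ∷ v) = ↭-refl
  qsh-comm (x ∷ u) []      = ↭-refl
  qsh-comm (x ∷ u) (y ∷ v) = begin
    x · qsh u (y ∷ v) ++ y · qsh (x ∷ u) v ++ (x ⊕ y) · qsh u v
      ↭⟨ ++⁺ (·-cong refl (qsh-comm u (y ∷ v))) (++⁺ (·-cong refl (qsh-comm (x ∷ u) v)) (·-cong (⊕-comm x y) (qsh-comm u v))) ⟩
    x · qsh (y ∷ v) u ++ y · qsh v (x ∷ u) ++ (y ⊕ x) · qsh v u
      ↭⟨ shifts (x · qsh (y ∷ v) u) (y · qsh v (x ∷ u)) ⟩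
    y · qsh v (x ∷ u) ++ x · qsh (y ∷ v) u ++ (y ⊕ x) · qsh v u ∎
    where open PermutationReasoning

  qshʳ : Word Ω → FormalSum Ω → FormalSum Ω
  qshʳ w L = concatMap (λ r → qsh r w) L

  qshˡ : Word Ω → FormalSum Ω → FormalSum Ω
  qshˡ u M = concatMap (qsh u) M

  qshʳ-· : ∀ x z w L → qshʳ (z ∷ w) (x · L) ↭ x · qshʳ (z ∷ w) L ++ z · qshʳ w (x · L) ++ (x ⊕ z) · qshʳ w L
  qshʳ-· x z w L = begin
    qshʳ (z ∷ w) (x · L)
      ≡⟨ List.concatMap-map _ _ L ⟩
    concatMap (λ r → x · qsh r (z ∷ w) ++ z · qsh (x ∷ r) w ++ (x ⊕ z) · qsh r w) L
      ↭⟨ concatMap-split₃ _ _ _ L ⟩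
    concatMap (λ r → x · qsh r (z ∷ w)) L ++ concatMap (λ r → z · qsh (x ∷ r) w) L ++ concatMap (λ r → (x ⊕ z) · qsh r w) L
      ≡⟨ cong₂ _++_ (sym (map-concatMap _ _ L))
           (cong₂ _++_ (trans (sym (map-concatMap _ _ L)) (cong (z ·_) (sym (List.concatMap-map _ _ L))))
                         (sym (map-concatMap _ _ L))) ⟩
    x · qshʳ (z ∷ w) L ++ z · qshʳ w (x · L) ++ (x ⊕ z) · qshʳ w L ∎
    where open PermutationReasoning

  qshˡ-· : ∀ x u y M → qshˡ (x ∷ u) (y · M) ↭ x · qshˡ u (y · M) ++ y · qshˡ (x ∷ u) M ++ (x ⊕ y) · qshˡ u M
  qshˡ-· x u y M = begin
    qshˡ (x ∷ u) (y · M)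
      ≡⟨ List.concatMap-map _ _ M ⟩
    concatMap (λ r → x · qsh u (y ∷ r) ++ y · qsh (x ∷ u) r ++ (x ⊕ y) · qsh u r) M
      ↭⟨ concatMap-split₃ _ _ _ M ⟩
    concatMap (λ r → x · qsh u (y ∷ r)) M ++ concatMap (λ r → y · qsh (x ∷ u) r) M ++ concatMap (λ r → (x ⊕ y) · qsh u r) M
      ≡⟨ cong₂ _++_ (trans (sym (map-concatMap _ _ M)) (cong (x ·_) (sym (List.concatMap-map _ _ M))))
           (cong₂ _++_ (sym (map-concatMap _ _ M)) (sym (map-concatMap _ _ M))) ⟩
    x · qshˡ u (y · M) ++ y · qshˡ (x ∷ u) M ++ (x ⊕ y) · qshˡ u M ∎
    where open PermutationReasoning

  private
    ·-++₃ : ∀ x L₁ L₂ L₃ → x · L₁ ++ x · L₂ ++ x · L₃ ≡ x · (L₁ ++ L₂ ++ L₃)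
    ·-++₃ x L₁ L₂ L₃ = sym (trans (List.map-++ _ L₁ _) (cong (x · L₁ ++_) (List.map-++ _ L₂ L₃)))

    concatMap-++₃ : (h : Word Ω → FormalSum Ω) (L₁ L₂ L₃ : FormalSum Ω) →
                     concatMap h (L₁ ++ L₂ ++ L₃) ≡ concatMap h L₁ ++ concatMap h L₂ ++ concatMap h L₃
    concatMap-++₃ h L₁ L₂ L₃ = trans (List.concatMap-++ h L₁ _) (cong (concatMap h L₁ ++_) (List.concatMap-++ h L₂ L₃))

  -- Both sides of associativity expand into seven terms, one for each non-empty set of first letters.
  qshʳ-expand : ∀ x u y v z w → qshʳ (z ∷ w) (qsh (x ∷ u) (y ∷ v)) ↭
      x · qshʳ (z ∷ w) (qsh u (y ∷ v)) ++ y · qshʳ (z ∷ w) (qsh (x ∷ u) v) ++ z · qshʳ w (qsh (x ∷ u) (y ∷ v))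
      ++ (x ⊕ y) · qshʳ (z ∷ w) (qsh u v) ++ (x ⊕ z) · qshʳ w (qsh u (y ∷ v)) ++ (y ⊕ z) · qshʳ w (qsh (x ∷ u) v)
      ++ ((x ⊕ y) ⊕ z) · qshʳ w (qsh u v)
  qshʳ-expand x u y v z w = begin
    qshʳ (z ∷ w) (x · L₁ ++ y · L₂ ++ (x ⊕ y) · L₃)
      ≡⟨ concatMap-++₃ _ (x · L₁) (y · L₂) ((x ⊕ y) · L₃) ⟩
    qshʳ (z ∷ w) (x · L₁) ++ qshʳ (z ∷ w) (y · L₂) ++ qshʳ (z ∷ w) ((x ⊕ y) · L₃)
      ↭⟨ ++⁺ (qshʳ-· x z w L₁) (++⁺ (qshʳ-· y z w L₂) (qshʳ-· (x ⊕ y) z w L₃)) ⟩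
    (X₁ ++ Z₁ ++ P₁) ++ (X₂ ++ Z₂ ++ P₂) ++ (X₃ ++ Z₃ ++ P₃)
      ↭⟨ regroup X₁ Z₁ P₁ X₂ Z₂ P₂ X₃ Z₃ P₃ ⟩
    X₁ ++ X₂ ++ (Z₁ ++ Z₂ ++ Z₃) ++ X₃ ++ P₁ ++ P₂ ++ P₃
      ≡⟨ cong (λ Z → X₁ ++ X₂ ++ Z ++ X₃ ++ P₁ ++ P₂ ++ P₃)
           (trans (·-++₃ z (qshʳ w (x · L₁)) (qshʳ w (y · L₂)) (qshʳ w ((x ⊕ y) · L₃)))
                  (cong (z ·_) (sym (concatMap-++₃ _ (x · L₁) (y · L₂) ((x ⊕ y) · L₃))))) ⟩
    X₁ ++ X₂ ++ z · qshʳ w (qsh (x ∷ u) (y ∷ v)) ++ X₃ ++ P₁ ++ P₂ ++ P₃ ∎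
    where
    open PermutationReasoning
    L₁ = qsh u (y ∷ v)
    L₂ = qsh (x ∷ u) v
    L₃ = qsh u v
    X₁ = x · qshʳ (z ∷ w) L₁
    Z₁ = z · qshʳ w (x · L₁)
    P₁ = (x ⊕ z) · qshʳ w L₁
    X₂ = y · qshʳ (z ∷ w) L₂
    Z₂ = z · qshʳ w (y · L₂)
    P₂ = (y ⊕ z) · qshʳ w L₂
    X₃ = (x ⊕ y) · qshʳ (z ∷ w) L₃
    Z₃ = z · qshʳ w ((x ⊕ y) · L₃)
    P₃ = ((x ⊕ y) ⊕ z) · qshʳ w L₃
    regroup : ∀ (X₁ Z₁ P₁ X₂ Z₂ P₂ X₃ Z₃ P₃ : FormalSum Ω) →
      (X₁ ++ Z₁ ++ P₁) ++ (X₂ ++ Z₂ ++ P₂) ++ (X₃ ++ Z₃ ++ P₃) ↭ X₁ ++ X₂ ++ (Z₁ ++ Z₂ ++ Z₃) ++ X₃ ++ P₁ ++ P₂ ++ P₃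
    regroup = ++-Solver.solve 9 (λ X₁ Z₁ P₁ X₂ Z₂ P₂ X₃ Z₃ P₃ →
      (X₁ ∪ Z₁ ∪ P₁) ∪ (X₂ ∪ Z₂ ∪ P₂) ∪ (X₃ ∪ Z₃ ∪ P₃) ⊜ X₁ ∪ X₂ ∪ (Z₁ ∪ Z₂ ∪ Z₃) ∪ X₃ ∪ P₁ ∪ P₂ ∪ P₃) ↭-refl
      where open ++-Solver using (_⊜_) renaming (_⊕_ to _∪_)

  qshˡ-expand : ∀ x u y v z w → qshˡ (x ∷ u) (qsh (y ∷ v) (z ∷ w)) ↭
      x · qshˡ u (qsh (y ∷ v) (z ∷ w)) ++ y · qshˡ (x ∷ u) (qsh v (z ∷ w)) ++ z · qshˡ (x ∷ u) (qsh (y ∷ v) w)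
      ++ (x ⊕ y) · qshˡ u (qsh v (z ∷ w)) ++ (x ⊕ z) · qshˡ u (qsh (y ∷ v) w) ++ (y ⊕ z) · qshˡ (x ∷ u) (qsh v w)
      ++ (x ⊕ (y ⊕ z)) · qshˡ u (qsh v w)
  qshˡ-expand x u y v z w = begin
    qshˡ (x ∷ u) (y · M₁ ++ z · M₂ ++ (y ⊕ z) · M₃)
      ≡⟨ concatMap-++₃ _ (y · M₁) (z · M₂) ((y ⊕ z) · M₃) ⟩
    qshˡ (x ∷ u) (y · M₁) ++ qshˡ (x ∷ u) (z · M₂) ++ qshˡ (x ∷ u) ((y ⊕ z) · M₃)
      ↭⟨ ++⁺ (qshˡ-· x u y M₁) (++⁺ (qshˡ-· x u z M₂) (qshˡ-· x u (y ⊕ z) M₃)) ⟩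
    (X₁ ++ Y₁ ++ P₁) ++ (X₂ ++ Y₂ ++ P₂) ++ (X₃ ++ Y₃ ++ P₃)
      ↭⟨ regroup X₁ Y₁ P₁ X₂ Y₂ P₂ X₃ Y₃ P₃ ⟩
    (X₁ ++ X₂ ++ X₃) ++ Y₁ ++ Y₂ ++ P₁ ++ P₂ ++ Y₃ ++ P₃
      ≡⟨ cong (λ X → X ++ Y₁ ++ Y₂ ++ P₁ ++ P₂ ++ Y₃ ++ P₃)
           (trans (·-++₃ x (qshˡ u (y · M₁)) (qshˡ u (z · M₂)) (qshˡ u ((y ⊕ z) · M₃)))
                    (cong (x ·_) (sym (concatMap-++₃ _ (y · M₁) (z · M₂) ((y ⊕ z) · M₃))))) ⟩
    x · qshˡ u (qsh (y ∷ v) (z ∷ w)) ++ Y₁ ++ Y₂ ++ P₁ ++ P₂ ++ Y₃ ++ P₃ ∎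
    where
    open PermutationReasoning
    M₁ = qsh v (z ∷ w)
    M₂ = qsh (y ∷ v) w
    M₃ = qsh v w
    X₁ = x · qshˡ u (y · M₁)
    Y₁ = y · qshˡ (x ∷ u) M₁
    P₁ = (x ⊕ y) · qshˡ u M₁
    X₂ = x · qshˡ u (z · M₂)
    Y₂ = z · qshˡ (x ∷ u) M₂
    P₂ = (x ⊕ z) · qshˡ u M₂
    X₃ = x · qshˡ u ((y ⊕ z) · M₃)
    Y₃ = (y ⊕ z) · qshˡ (x ∷ u) M₃
    P₃ = (x ⊕ (y ⊕ z)) · qshˡ u M₃
    regroup : ∀ (X₁ Y₁ P₁ X₂ Y₂ P₂ X₃ Y₃ P₃ : FormalSum Ω) →
      (X₁ ++ Y₁ ++ P₁) ++ (X₂ ++ Y₂ ++ P₂) ++ (X₃ ++ Y₃ ++ P₃) ↭ (X₁ ++ X₂ ++ X₃) ++ Y₁ ++ Y₂ ++ P₁ ++ P₂ ++ Y₃ ++ P₃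
    regroup = ++-Solver.solve 9 (λ X₁ Y₁ P₁ X₂ Y₂ P₂ X₃ Y₃ P₃ →
      (X₁ ∪ Y₁ ∪ P₁) ∪ (X₂ ∪ Y₂ ∪ P₂) ∪ (X₃ ∪ Y₃ ∪ P₃) ⊜ (X₁ ∪ X₂ ∪ X₃) ∪ Y₁ ∪ Y₂ ∪ P₁ ∪ P₂ ∪ Y₃ ∪ P₃) ↭-refl
      where open ++-Solver using (_⊜_) renaming (_⊕_ to _∪_)

  qsh-assoc : ∀ u v w → qshʳ w (qsh u v) ↭ qshˡ u (qsh v w)
  qsh-assoc []      v       w       = ↭-reflexive (trans (List.++-identityʳ (qsh v w)) (sym (List.concatMap-pure (qsh v w))))
  qsh-assoc (x ∷ u) []      w       = ↭-refl
  qsh-assoc (x ∷ u) (y ∷ v) []      =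
    ↭-reflexive (trans (List.concatMap-cong qsh-[]ʳ (qsh (x ∷ u) (y ∷ v)))
                       (trans (List.concatMap-pure _) (sym (List.++-identityʳ _))))
  qsh-assoc (x ∷ u) (y ∷ v) (z ∷ w) = begin
    qshʳ (z ∷ w) (qsh (x ∷ u) (y ∷ v))
      ↭⟨ qshʳ-expand x u y v z w ⟩
    x · qshʳ (z ∷ w) (qsh u (y ∷ v)) ++ y · qshʳ (z ∷ w) (qsh (x ∷ u) v) ++ z · qshʳ w (qsh (x ∷ u) (y ∷ v))
      ++ (x ⊕ y) · qshʳ (z ∷ w) (qsh u v) ++ (x ⊕ z) · qshʳ w (qsh u (y ∷ v)) ++ (y ⊕ z) · qshʳ w (qsh (x ∷ u) v)
      ++ ((x ⊕ y) ⊕ z) · qshʳ w (qsh u v)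
      ↭⟨ ++⁺ (·-cong refl (qsh-assoc u (y ∷ v) (z ∷ w))) (++⁺ (·-cong refl (qsh-assoc (x ∷ u) v (z ∷ w)))
          (++⁺ (·-cong refl (qsh-assoc (x ∷ u) (y ∷ v) w)) (++⁺ (·-cong refl (qsh-assoc u v (z ∷ w)))
          (++⁺ (·-cong refl (qsh-assoc u (y ∷ v) w)) (++⁺ (·-cong refl (qsh-assoc (x ∷ u) v w))
               (·-cong (⊕-assoc x y z) (qsh-assoc u v w))))))) ⟩
    x · qshˡ u (qsh (y ∷ v) (z ∷ w)) ++ y · qshˡ (x ∷ u) (qsh v (z ∷ w)) ++ z · qshˡ (x ∷ u) (qsh (y ∷ v) w)
      ++ (x ⊕ y) · qshˡ u (qsh v (z ∷ w)) ++ (x ⊕ z) · qshˡ u (qsh (y ∷ v) w) ++ (y ⊕ z) · qshˡ (x ∷ u) (qsh v w)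
      ++ (x ⊕ (y ⊕ z)) · qshˡ u (qsh v w)
      ↭⟨ qshˡ-expand x u y v z w ⟨
    qshˡ (x ∷ u) (qsh (y ∷ v) (z ∷ w)) ∎
    where open PermutationReasoning

  ⧢-cong : ∀ {L L′ M M′} → L ↭ L′ → M ↭ M′ → L ⧢ M ↭ L′ ⧢ M′
  ⧢-cong {L} {L′} {M} {M′} L↭L′ M↭M′ =
    ↭-trans (concatMap-↭ (λ u → concatMap (qsh u) M) L↭L′) (concatMap⁺ (λ u → concatMap-↭ (qsh u) M↭M′) L′)

  ⧢-congˡ : ∀ L {M M′} → M ↭ M′ → L ⧢ M ↭ L ⧢ M′
  ⧢-congˡ L = ⧢-cong (↭-refl {x = L})

  ⧢-congʳ : ∀ {L L′} M → L ↭ L′ → L ⧢ M ↭ L′ ⧢ M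
  ⧢-congʳ M L↭L′ = ⧢-cong L↭L′ (↭-refl {x = M})

  ⧢-comm : ∀ L M → L ⧢ M ↭ M ⧢ L
  ⧢-comm L M = ↭-trans (concatMap-swap qsh L M) (concatMap⁺ (λ v → concatMap⁺ (λ u → qsh-comm u v) L) M)

  ⧢-assoc : ∀ L M N → (L ⧢ M) ⧢ N ↭ L ⧢ (M ⧢ N)
  ⧢-assoc L M N = begin
    concatMap (λ r → qshˡ r N) (concatMap (λ u → qshˡ u M) L)
      ≡⟨ concatMap-concatMap (λ r → qshˡ r N) (λ u → qshˡ u M) L ⟩
    concatMap (λ u → concatMap (λ r → qshˡ r N) (qshˡ u M)) L
      ≡⟨ List.concatMap-cong (λ u → concatMap-concatMap (λ r → qshˡ r N) (qsh u) M) L ⟩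
    concatMap (λ u → concatMap (λ v → concatMap (λ r → qshˡ r N) (qsh u v)) M) L
      ↭⟨ concatMap⁺ (λ u → concatMap⁺ (λ v → concatMap-swap qsh (qsh u v) N) M) L ⟩
    concatMap (λ u → concatMap (λ v → concatMap (λ w → qshʳ w (qsh u v)) N) M) L
      ↭⟨ concatMap⁺ (λ u → concatMap⁺ (λ v → concatMap⁺ (λ w → qsh-assoc u v w) N) M) L ⟩
    concatMap (λ u → concatMap (λ v → concatMap (λ w → qshˡ u (qsh v w)) N) M) L
      ≡⟨ List.concatMap-cong (λ u → List.concatMap-cong (λ v → concatMap-concatMap (qsh u) (qsh v) N) M) L ⟨
    concatMap (λ u → concatMap (λ v → qshˡ u (qshˡ v N)) M) L
      ≡⟨ List.concatMap-cong (λ u → concatMap-concatMap (qsh u) (λ v → qshˡ v N) M) L ⟨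
    L ⧢ (M ⧢ N) ∎
    where open PermutationReasoning

  ⧢-identityˡ : ∀ M → [ [] ] ⧢ M ≡ M
  ⧢-identityˡ M = trans (List.++-identityʳ _) (List.concatMap-pure M)

  ⧢-identityʳ : ∀ L → L ⧢ [ [] ] ≡ L
  ⧢-identityʳ L = trans (List.concatMap-cong (λ u → trans (List.++-identityʳ (qsh u [])) (qsh-[]ʳ u)) L) (List.concatMap-pure L)

  ⧢-singletons : ∀ u v → [ u ] ⧢ [ v ] ≡ qsh u v
  ⧢-singletons u v = trans (List.++-identityʳ _) (List.++-identityʳ _)

  ⧢-concatMapʳ : ∀ {b} {A : Set b} L (F : A → FormalSum Ω) xs → concatMap (λ x → L ⧢ F x) xs ↭ L ⧢ concatMap F xs
  ⧢-concatMapʳ L F xs = begin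
    concatMap (λ x → concatMap (λ u → qshˡ u (F x)) L) xs ↭⟨ concatMap-swap (λ x u → qshˡ u (F x)) xs L ⟩
    concatMap (λ u → concatMap (λ x → qshˡ u (F x)) xs) L ≡⟨ List.concatMap-cong (λ u → concatMap-concatMap (qsh u) F xs) L ⟨
    L ⧢ concatMap F xs                                     ∎
    where open PermutationReasoning

  ⧢-concatMapˡ : ∀ {b} {A : Set b} (F : A → FormalSum Ω) xs M → concatMap (λ x → F x ⧢ M) xs ≡ concatMap F xs ⧢ M
  ⧢-concatMapˡ F xs M = sym (concatMap-concatMap (λ u → qshˡ u M) F xs)

  ⧢-product : List (FormalSum Ω) → FormalSum Ω
  ⧢-product = List.foldr _⧢_ [ [] ]

  ⧢-all≡⧢-product : ∀ ws → ⧢-all ws ≡ ⧢-product (List.map [_] ws)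
  ⧢-all≡⧢-product []       = refl
  ⧢-all≡⧢-product (w ∷ ws) = cong ([ w ] ⧢_) (⧢-all≡⧢-product ws)

  ⧢-interchange : ∀ L M N P → (L ⧢ M) ⧢ (N ⧢ P) ↭ (L ⧢ N) ⧢ (M ⧢ P)
  ⧢-interchange L M N P = begin
    (L ⧢ M) ⧢ (N ⧢ P) ↭⟨ ⧢-assoc L M (N ⧢ P) ⟩
    L ⧢ (M ⧢ (N ⧢ P)) ↭⟨ ⧢-congˡ L (⧢-assoc M N P) ⟨
    L ⧢ ((M ⧢ N) ⧢ P) ↭⟨ ⧢-congˡ L (⧢-congʳ P (⧢-comm M N)) ⟩
    L ⧢ ((N ⧢ M) ⧢ P) ↭⟨ ⧢-congˡ L (⧢-assoc N M P) ⟩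
    L ⧢ (N ⧢ (M ⧢ P)) ↭⟨ ⧢-assoc L N (M ⧢ P) ⟨
    (L ⧢ N) ⧢ (M ⧢ P) ∎
    where open PermutationReasoning

  ⧢-product-⧢ : ∀ {b} {A : Set b} (F G : A → FormalSum Ω) xs →
                ⧢-product (List.map (λ x → F x ⧢ G x) xs) ↭ ⧢-product (List.map F xs) ⧢ ⧢-product (List.map G xs)
  ⧢-product-⧢ F G []       = ↭-reflexive (sym (⧢-identityˡ [ [] ]))
  ⧢-product-⧢ F G (x ∷ xs) =
    ↭-trans (⧢-congˡ (F x ⧢ G x) (⧢-product-⧢ F G xs))
            (⧢-interchange (F x) (G x) (⧢-product (List.map F xs)) (⧢-product (List.map G xs)))

-- Products of fibres

map-allFin-suc : ∀ {b} {B : Set b} {s} (f : Fin (suc s) → B) {g : Fin s → B} → (∀ k → f (suc k) ≡ g k) →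
                 List.map f (allFin (suc s)) ≡ f zero ∷ List.map g (allFin s)
map-allFin-suc f {g} f∘suc≗g =
  cong (f zero ∷_) (trans (List.map-tabulate suc f) (trans (List.tabulate-cong f∘suc≗g) (sym (List.map-tabulate id g))))

fibres-separated : ∀ {t} (wL : Vec A p) (σL : Vec (Fin t) p) (wR : Vec A q) (σR : Vec (Fin t) q) (r : ℕ) →
  (∀ i → toℕ (lookup σL i) ℕ.< r) → (∀ j → r ℕ.≤ toℕ (lookup σR j)) →
  ∀ k → fibre wL σL k ≡ [] ⊎ fibre wR σR k ≡ []
fibres-separated wL σL wR σR r σL<r r≤σR k with toℕ k ℕ.<? r
... | yes k<r = inj₂ (fibre-∉ wR σR k (λ j σRj≡k → ℕ.<⇒≱ k<r (subst (λ x → r ℕ.≤ toℕ x) σRj≡k (r≤σR j))))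
... | no  k≮r = inj₁ (fibre-∉ wL σL k (λ i σLi≡k → k≮r (subst (λ x → toℕ x ℕ.< r) σLi≡k (σL<r i))))

factorisation-sameEqualities : ∀ {t} (f : Vec (Fin s) n) (σ : Vec (Fin t) n) (δ : Vec (Fin s) t) →
  (∀ i → lookup f i ≡ lookup δ (lookup σ i)) →
  (∀ i j → lookup δ (lookup σ i) ≡ lookup δ (lookup σ j) → lookup σ i ≡ lookup σ j) → SameEqualities f σ
factorisation-sameEqualities f σ δ f≡δσ δ-injective =
  (λ i j fi≡fj → δ-injective i j (trans (sym (f≡δσ i)) (trans fi≡fj (f≡δσ j)))) ,
  (λ i j σi≡σj → trans (f≡δσ i) (trans (cong (lookup δ) σi≡σj) (sym (f≡δσ j))))

increasing⇒injective : ∀ {t} {R : Fin t → Set} (δ : Vec (Fin s) t) → (∀ a b → a < b → R a → R b → lookup δ a < lookup δ b) →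
                       ∀ {a b} → R a → R b → lookup δ a ≡ lookup δ b → a ≡ b
increasing⇒injective δ increasing {a} {b} Ra Rb δa≡δb with <-cmp a b
... | tri< a<b _ _ = ⊥-elim (<-irrefl δa≡δb (increasing a b a<b Ra Rb))
... | tri≈ _ a≡b _ = a≡b
... | tri> _ _ b<a = ⊥-elim (<-irrefl (sym δa≡δb) (increasing b a b<a Rb Ra))

module FibreProducts {a} {Ω : Set a} (_⊕_ : Ω → Ω → Ω)
                     (⊕-isCommutativeSemigroup : IsCommutativeSemigroup _≡_ _⊕_) where

  open QuasiShuffle _⊕_ using (qsh; _⧢_; ⧢-all)
  open QuasiShuffleAlgebra _⊕_ ⊕-isCommutativeSemigroup
  open MergedWords _⊕_
  open Sides _⊕_ using (lhs; rhs)
  open Contract _⊕_ using (subOfContract)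

  fibreProduct : ∀ {n s} → Vec Ω n → Vec (Fin s) n → FormalSum Ω
  fibreProduct {s = s} w μ = ⧢-all (List.map (fibre w μ) (allFin s))

  fibreProduct-peel : ∀ {n n′ s} (w : Vec Ω n) (μ : Vec (Fin (suc s)) n) (w′ : Vec Ω n′) (μ′ : Vec (Fin s) n′) →
    (∀ k → fibre w μ (suc k) ≡ fibre w′ μ′ k) → fibreProduct w μ ≡ [ fibre w μ zero ] ⧢ fibreProduct w′ μ′
  fibreProduct-peel w μ w′ μ′ eq = cong ⧢-all (map-allFin-suc (fibre w μ) eq)

  pairedProduct : ∀ {p q s} → Vec Ω p → Vec (Fin s) p → Vec Ω q → Vec (Fin s) q → FormalSum Ω
  pairedProduct {s = s} wL fL wR fR = ⧢-product (List.map (λ k → qsh (fibre wL fL k) (fibre wR fR k)) (allFin s))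

  qshφ-sum : ∀ {p q s} → Vec Ω p → Vec (Fin s) p → Vec Ω q → Vec (Fin s) q → FormalSum Ω
  qshφ-sum wL fL wR fR = concatMap (λ π → fibreProduct (merge _⊕_ π wL wR) (labels π fL fR)) (qshφ fL fR)

  private
    concatMap-singletons : ∀ {b} {A : Set b} (g : A → Word Ω) xs → concatMap (λ x → [ g x ]) xs ≡ List.map g xs
    concatMap-singletons g xs = trans (sym (List.concatMap-map [_] g xs)) (List.concatMap-pure (List.map g xs))

  qshφ-sum-zeroBlocks : ∀ {a₀ b₀ p q s} (wL₀ : Vec Ω a₀) (wL : Vec Ω p) (wR₀ : Vec Ω b₀) (wR : Vec Ω q)
    (fL : Vec (Fin s) p) (fR : Vec (Fin s) q) →
    qshφ-sum (wL₀ Vec.++ wL) (replicate a₀ zero Vec.++ Vec.map suc fL) (wR₀ Vec.++ wR) (replicate b₀ zero Vec.++ Vec.map suc fR)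
      ↭ qsh (toList wL₀) (toList wR₀) ⧢ qshφ-sum wL fL wR fR
  qshφ-sum-zeroBlocks {a₀} {b₀} wL₀ wL wR₀ wR fL fR = begin
    concatMap F (qshφ (replicate a₀ zero Vec.++ Vec.map suc fL) (replicate b₀ zero Vec.++ Vec.map suc fR))
      ≡⟨ cong (concatMap F) (qshφ-zeroBlocks a₀ b₀ fL fR) ⟩
    concatMap F (prefixAll Π G)
      ≡⟨ concatMap-concatMap F (λ π → List.map (π ++ᵖ_) G) Π ⟩
    concatMap (λ π → concatMap F (List.map (π ++ᵖ_) G)) Π
      ≡⟨ List.concatMap-cong (λ π → trans (List.concatMap-map F (π ++ᵖ_) G) (List.concatMap-cong (F-++ᵖ π) G)) Π ⟩
    concatMap (λ π → concatMap (λ ρ → [ merged wL₀ wR₀ π ] ⧢ F′ ρ) G) Π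
      ↭⟨ concatMap⁺ (λ π → ⧢-concatMapʳ [ merged wL₀ wR₀ π ] F′ G) Π ⟩
    concatMap (λ π → [ merged wL₀ wR₀ π ] ⧢ qshφ-sum wL fL wR fR) Π
      ≡⟨ ⧢-concatMapˡ (λ π → [ merged wL₀ wR₀ π ]) Π (qshφ-sum wL fL wR fR) ⟩
    concatMap (λ π → [ merged wL₀ wR₀ π ]) Π ⧢ qshφ-sum wL fL wR fR
      ≡⟨ cong (_⧢ qshφ-sum wL fL wR fR) (trans (concatMap-singletons (merged wL₀ wR₀) Π) (map-merged-allPaths wL₀ wR₀)) ⟩
    qsh (toList wL₀) (toList wR₀) ⧢ qshφ-sum wL fL wR fR ∎
    where
    open PermutationReasoning
    Π = allPaths a₀ b₀
    G = qshφ fL fR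
    F = λ π → fibreProduct (merge _⊕_ π (wL₀ Vec.++ wL) (wR₀ Vec.++ wR))
                           (labels π (replicate a₀ zero Vec.++ Vec.map suc fL) (replicate b₀ zero Vec.++ Vec.map suc fR))
    F′ = λ ρ → fibreProduct (merge _⊕_ ρ wL wR) (labels ρ fL fR)
    F-++ᵖ : ∀ π ρ → F (π ++ᵖ ρ) ≡ [ merged wL₀ wR₀ π ] ⧢ F′ ρ
    F-++ᵖ π ρ = trans (fibreProduct-peel (merge _⊕_ (π ++ᵖ ρ) (wL₀ Vec.++ wL) (wR₀ Vec.++ wR))
                        (labels (π ++ᵖ ρ) (replicate a₀ zero Vec.++ Vec.map suc fL) (replicate b₀ zero Vec.++ Vec.map suc fR))
                        (merge _⊕_ ρ wL wR) (labels ρ fL fR) (fibre-++ᵖ-suc π ρ wL₀ wL wR₀ wR fL fR))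
                      (cong (λ w → [ w ] ⧢ F′ ρ) (fibre-++ᵖ-zero π ρ wL₀ wL wR₀ wR fL fR))

  pairedProduct-zeroBlocks : ∀ {a₀ b₀ p q s} (wL₀ : Vec Ω a₀) (wL : Vec Ω p) (wR₀ : Vec Ω b₀) (wR : Vec Ω q)
    (fL : Vec (Fin s) p) (fR : Vec (Fin s) q) →
    pairedProduct (wL₀ Vec.++ wL) (replicate a₀ zero Vec.++ Vec.map suc fL) (wR₀ Vec.++ wR) (replicate b₀ zero Vec.++ Vec.map suc fR)
      ≡ qsh (toList wL₀) (toList wR₀) ⧢ pairedProduct wL fL wR fR
  pairedProduct-zeroBlocks {a₀} {b₀} wL₀ wL wR₀ wR fL fR =
    trans (cong ⧢-product (map-allFin-suc pair (λ k → cong₂ qsh (fibre-zeroBlock-suc wL₀ wL fL k) (fibre-zeroBlock-suc wR₀ wR fR k))))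
          (cong (_⧢ pairedProduct wL fL wR fR) (cong₂ qsh (fibre-zeroBlock-zero wL₀ wL fL) (fibre-zeroBlock-zero wR₀ wR fR)))
    where
    pair = λ k → qsh (fibre (wL₀ Vec.++ wL) (replicate a₀ zero Vec.++ Vec.map suc fL) k)
                     (fibre (wR₀ Vec.++ wR) (replicate b₀ zero Vec.++ Vec.map suc fR) k)

  qshφ-sum↭pairedProduct : ∀ s {p q} (wL : Vec Ω p) (fL : Vec (Fin s) p) (wR : Vec Ω q) (fR : Vec (Fin s) q) →
    Nondecreasing fL → Nondecreasing fR → qshφ-sum wL fL wR fR ↭ pairedProduct wL fL wR fR
  qshφ-sum↭pairedProduct zero    []      []       []      []       _   _   = ↭-reflexive (List.++-identityʳ _)
  qshφ-sum↭pairedProduct zero    (_ ∷ _) (() ∷ _) _       _        _   _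
  qshφ-sum↭pairedProduct zero    []      []       (_ ∷ _) (() ∷ _) _   _
  qshφ-sum↭pairedProduct (suc s) wL      fL       wR      fR       ndL ndR
    with zeroBlock-view fL ndL | zeroBlock-view fR ndR
  ... | zeroBlock a₀ fL′ ndL′ | zeroBlock b₀ fR′ ndR′ with Vec.splitAt a₀ wL | Vec.splitAt b₀ wR
  ...   | wL₀ , wL′ , refl | wR₀ , wR′ , refl = begin
    qshφ-sum (wL₀ Vec.++ wL′) (Z a₀ fL′) (wR₀ Vec.++ wR′) (Z b₀ fR′) ↭⟨ qshφ-sum-zeroBlocks wL₀ wL′ wR₀ wR′ fL′ fR′ ⟩
    qsh (toList wL₀) (toList wR₀) ⧢ qshφ-sum wL′ fL′ wR′ fR′
      ↭⟨ ⧢-congˡ (qsh (toList wL₀) (toList wR₀)) (qshφ-sum↭pairedProduct s wL′ fL′ wR′ fR′ ndL′ ndR′) ⟩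
    qsh (toList wL₀) (toList wR₀) ⧢ pairedProduct wL′ fL′ wR′ fR′ ≡⟨ pairedProduct-zeroBlocks wL₀ wL′ wR₀ wR′ fL′ fR′ ⟨
    pairedProduct (wL₀ Vec.++ wL′) (Z a₀ fL′) (wR₀ Vec.++ wR′) (Z b₀ fR′) ∎
    where
    open PermutationReasoning
    Z : ∀ a {n} → Vec (Fin s) n → Vec (Fin (suc s)) (a + n)
    Z a v = replicate a zero Vec.++ Vec.map suc v

  fibreProduct-singletons : ∀ {n s} (w : Vec Ω n) (μ : Vec (Fin s) n) →
                            fibreProduct w μ ≡ ⧢-product (List.map (λ k → [ fibre w μ k ]) (allFin s))
  fibreProduct-singletons {s = s} w μ =
    trans (⧢-all≡⧢-product (List.map (fibre w μ) (allFin s))) (cong ⧢-product (sym (List.map-∘ {g = [_]} {f = fibre w μ} (allFin s))))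

  pairedProduct-split : ∀ {p q s} (wL : Vec Ω p) (fL : Vec (Fin s) p) (wR : Vec Ω q) (fR : Vec (Fin s) q) →
                        pairedProduct wL fL wR fR ↭ fibreProduct wL fL ⧢ fibreProduct wR fR
  pairedProduct-split wL fL wR fR = begin
    ⧢-product (List.map (λ k → qsh (fibre wL fL k) (fibre wR fR k)) (allFin _))
      ≡⟨ cong ⧢-product (List.map-cong (λ k → sym (⧢-singletons (fibre wL fL k) (fibre wR fR k))) (allFin _)) ⟩
    ⧢-product (List.map (λ k → [ fibre wL fL k ] ⧢ [ fibre wR fR k ]) (allFin _))
      ↭⟨ ⧢-product-⧢ (λ k → [ fibre wL fL k ]) (λ k → [ fibre wR fR k ]) (allFin _) ⟩
    ⧢-product (List.map (λ k → [ fibre wL fL k ]) (allFin _)) ⧢ ⧢-product (List.map (λ k → [ fibre wR fR k ]) (allFin _))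
      ≡⟨ cong₂ _⧢_ (fibreProduct-singletons wL fL) (fibreProduct-singletons wR fR) ⟨
    fibreProduct wL fL ⧢ fibreProduct wR fR ∎
    where open PermutationReasoning

  fibreProduct-++ : ∀ {p q s} (wL : Vec Ω p) (μL : Vec (Fin s) p) (wR : Vec Ω q) (μR : Vec (Fin s) q) →
    (∀ k → fibre wL μL k ≡ [] ⊎ fibre wR μR k ≡ []) →
    fibreProduct (wL Vec.++ wR) (μL Vec.++ μR) ↭ fibreProduct wL μL ⧢ fibreProduct wR μR
  fibreProduct-++ wL μL wR μR disjoint = begin
    fibreProduct (wL Vec.++ wR) (μL Vec.++ μR)
      ≡⟨ fibreProduct-singletons (wL Vec.++ wR) (μL Vec.++ μR) ⟩
    ⧢-product (List.map (λ k → [ fibre (wL Vec.++ wR) (μL Vec.++ μR) k ]) (allFin _))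
      ≡⟨ cong ⧢-product (List.map-cong (λ k → trans (cong [_] (fibre-++ wL wR μL μR k)) (singleton-++ (disjoint k))) (allFin _)) ⟩
    ⧢-product (List.map (λ k → [ fibre wL μL k ] ⧢ [ fibre wR μR k ]) (allFin _))
      ↭⟨ ⧢-product-⧢ (λ k → [ fibre wL μL k ]) (λ k → [ fibre wR μR k ]) (allFin _) ⟩
    ⧢-product (List.map (λ k → [ fibre wL μL k ]) (allFin _)) ⧢ ⧢-product (List.map (λ k → [ fibre wR μR k ]) (allFin _))
      ≡⟨ cong₂ _⧢_ (fibreProduct-singletons wL μL) (fibreProduct-singletons wR μR) ⟨
    fibreProduct wL μL ⧢ fibreProduct wR μR ∎
    where
    open PermutationReasoning
    singleton-++ : ∀ {u v : Word Ω} → u ≡ [] ⊎ v ≡ [] → [ u ++ v ] ≡ [ u ] ⧢ [ v ]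
    singleton-++ (inj₁ refl)             = sym (⧢-identityˡ _)
    singleton-++ {u} (inj₂ refl) = trans (cong [_] (List.++-identityʳ u)) (sym (⧢-identityʳ [ u ]))

  fibreProduct-blocks : ∀ s {n} (w : Vec Ω n) (μ : Vec (Fin s) n) → Nondecreasing μ →
                        fibreProduct w μ ≡ ⧢-all (blocks (toList w) (adjacentEqualities μ))
  fibreProduct-blocks zero    []      []       _  = refl
  fibreProduct-blocks zero    (_ ∷ _) (() ∷ _) _
  fibreProduct-blocks (suc s) w       μ        nd with zeroBlock-view μ nd
  ... | zeroBlock a₀ μ′ nd′ with Vec.splitAt a₀ w
  ...   | w₀ , w′ , refl = begin
    fibreProduct (w₀ Vec.++ w′) (replicate a₀ zero Vec.++ Vec.map suc μ′)
      ≡⟨ fibreProduct-peel (w₀ Vec.++ w′) (replicate a₀ zero Vec.++ Vec.map suc μ′) w′ μ′ (fibre-zeroBlock-suc w₀ w′ μ′) ⟩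
    [ fibre (w₀ Vec.++ w′) (replicate a₀ zero Vec.++ Vec.map suc μ′) zero ] ⧢ fibreProduct w′ μ′
      ≡⟨ cong₂ (λ u M → [ u ] ⧢ M) (fibre-zeroBlock-zero w₀ w′ μ′) (fibreProduct-blocks s w′ μ′ nd′) ⟩
    [ toList w₀ ] ⧢ ⧢-all (blocks (toList w′) (adjacentEqualities μ′))
      ≡⟨ prepend-block w₀ ⟩
    ⧢-all (blocks (toList (w₀ Vec.++ w′)) (adjacentEqualities (replicate a₀ zero Vec.++ Vec.map suc μ′))) ∎
    where
    open ≡-Reasoning
    prepend-block : ∀ {a₀} (w₀ : Vec Ω a₀) → [ toList w₀ ] ⧢ ⧢-all (blocks (toList w′) (adjacentEqualities μ′))
                    ≡ ⧢-all (blocks (toList (w₀ Vec.++ w′)) (adjacentEqualities (replicate a₀ zero Vec.++ Vec.map suc μ′)))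
    prepend-block []       = trans (⧢-identityˡ _) (cong (⧢-all ∘ blocks (toList w′)) (sym (adjacentEqualities-map-suc μ′)))
    prepend-block (x ∷ w₀) = cong ⧢-all (sym (blocks-zeroBlock x w₀ w′ μ′))

  fibreProduct-relabel : ∀ {s t n} (w : Vec Ω n) (μ : Vec (Fin s) n) (ν : Vec (Fin t) n) → Nondecreasing μ → Nondecreasing ν →
                         SameEqualities μ ν → fibreProduct w μ ≡ fibreProduct w ν
  fibreProduct-relabel {s} {t} w μ ν ndμ ndν μ≈ν = begin
    fibreProduct w μ                                  ≡⟨ fibreProduct-blocks s w μ ndμ ⟩
    ⧢-all (blocks (toList w) (adjacentEqualities μ)) ≡⟨ cong (λ bs → ⧢-all (blocks (toList w) bs)) (adjacentEqualities-cong μ ν μ≈ν) ⟩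
    ⧢-all (blocks (toList w) (adjacentEqualities ν)) ≡⟨ fibreProduct-blocks t w ν ndν ⟨
    fibreProduct w ν                                  ∎
    where open ≡-Reasoning

  lhs↭qshφ-sum : ∀ {p q s} (wL : Vec Ω p) (wR : Vec Ω q) (fL : Vec (Fin s) p) (fR : Vec (Fin s) q)
    (ndL : Nondecreasing fL) (ndR : Nondecreasing fR) (E : List (QEntry (p + q) s)) → IsEnumeration p (fL Vec.++ fR) E →
    lhs (wL Vec.++ wR) E ↭ qshφ-sum wL fL wR fR
  lhs↭qshφ-sum {s = s} wL wR fL fR ndL ndR E isEnumeration = begin
    concatMap T E                                     ↭⟨ concatMap-↭ T (enumeration↭entries fL fR ndL ndR E isEnumeration) ⟩
    concatMap T (List.map (entry fL fR) (qshφ fL fR)) ≡⟨ List.concatMap-map T (entry fL fR) (qshφ fL fR) ⟩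
    concatMap (T ∘ entry fL fR) (qshφ fL fR)         ≡⟨ List.concatMap-cong (λ π → cong ⧢-all
                                                            (List.map-cong (subOfContract-positions π wL wR (labels π fL fR)) (allFin s))) (qshφ fL fR) ⟩
    qshφ-sum wL fL wR fR                              ∎
    where
    open PermutationReasoning
    T : QEntry _ s → FormalSum Ω
    T (_ , η , τ) = ⧢-all (List.map (subOfContract (wL Vec.++ wR) η τ) (allFin s))

  rhs≡fibreProduct : ∀ {n t} (w : Vec Ω n) (σ : Vec (Fin t) n) → rhs w σ ≡ fibreProduct w σ
  rhs≡fibreProduct {t = t} w σ = cong ⧢-all (List.map-cong (subword≡fibre w σ) (allFin t))

  lhs↭rhs : ∀ {p q s t} (wL : Vec Ω p) (wR : Vec Ω q) (fL : Vec (Fin s) p) (fR : Vec (Fin s) q)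
    (σL : Vec (Fin t) p) (σR : Vec (Fin t) q) (δ : Vec (Fin s) t) (r : ℕ) →
    Nondecreasing fL → Nondecreasing fR → Nondecreasing σL → Nondecreasing σR →
    (∀ i → toℕ (lookup σL i) ℕ.< r) → (∀ j → r ℕ.≤ toℕ (lookup σR j)) → IsQsh r δ →
    (∀ i → lookup fL i ≡ lookup δ (lookup σL i)) → (∀ j → lookup fR j ≡ lookup δ (lookup σR j)) →
    (E : List (QEntry (p + q) s)) → IsEnumeration p (fL Vec.++ fR) E →
    lhs (wL Vec.++ wR) E ↭ rhs (wL Vec.++ wR) (σL Vec.++ σR)
  lhs↭rhs {s = s} wL wR fL fR σL σR δ r ndL ndR ndσL ndσR σL<r r≤σR (_ , δ-increasingˡ , δ-increasingʳ) fL≡δσL fR≡δσR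
          E isEnumeration = begin
    lhs (wL Vec.++ wR) E                       ↭⟨ lhs↭qshφ-sum wL wR fL fR ndL ndR E isEnumeration ⟩
    qshφ-sum wL fL wR fR                       ↭⟨ qshφ-sum↭pairedProduct s wL fL wR fR ndL ndR ⟩
    pairedProduct wL fL wR fR                  ↭⟨ pairedProduct-split wL fL wR fR ⟩
    fibreProduct wL fL ⧢ fibreProduct wR fR    ≡⟨ cong₂ _⧢_ (fibreProduct-relabel wL fL σL ndL ndσL sameˡ)
                                                            (fibreProduct-relabel wR fR σR ndR ndσR sameʳ) ⟩
    fibreProduct wL σL ⧢ fibreProduct wR σR    ↭⟨ fibreProduct-++ wL σL wR σR (fibres-separated wL σL wR σR r σL<r r≤σR) ⟨
    fibreProduct (wL Vec.++ wR) (σL Vec.++ σR) ≡⟨ rhs≡fibreProduct (wL Vec.++ wR) (σL Vec.++ σR) ⟨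
    rhs (wL Vec.++ wR) (σL Vec.++ σR)          ∎
    where
    open PermutationReasoning
    sameˡ : SameEqualities fL σL
    sameˡ = factorisation-sameEqualities fL σL δ fL≡δσL (λ i j →
              increasing⇒injective δ (λ a b a<b _ b<r → δ-increasingˡ a b a<b b<r) (σL<r i) (σL<r j))
    sameʳ : SameEqualities fR σR
    sameʳ = factorisation-sameEqualities fR σR δ fR≡δσR (λ i j →
              increasing⇒injective δ (λ a b a<b r≤a _ → δ-increasingʳ a b a<b r≤a) (r≤σR i) (r≤σR j))

-- The hypotheses on the two halves

module _ (u : Vec (Fin s) p) (v : Vec (Fin s) q) where

  ++-monotone⁻ : (∀ i j → i ≤ j → toℕ j ℕ.< p → lookup (u Vec.++ v) i ≤ lookup (u Vec.++ v) j) →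
                 (∀ i j → i ≤ j → p ℕ.≤ toℕ i → lookup (u Vec.++ v) i ≤ lookup (u Vec.++ v) j) →
                 Nondecreasing u × Nondecreasing v
  ++-monotone⁻ monotoneˡ monotoneʳ =
    (λ i j i≤j → subst₂ _≤_ (Vec.lookup-++ˡ u v i) (Vec.lookup-++ˡ u v j) (monotoneˡ _ _ (↑ˡ-≤ q i≤j) (↑ˡ<p q j))) ,
    (λ i j i≤j → subst₂ _≤_ (Vec.lookup-++ʳ u v i) (Vec.lookup-++ʳ u v j) (monotoneʳ _ _ (↑ʳ-≤ p i≤j) (p≤↑ʳ p i)))

  IsWeakQsh-++⁻ : IsWeakQsh p (u Vec.++ v) → Nondecreasing u × Nondecreasing v
  IsWeakQsh-++⁻ (_ , monotoneˡ , monotoneʳ) = ++-monotone⁻ monotoneˡ monotoneʳ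

  Nondecreasing-++⁻ : Nondecreasing (u Vec.++ v) → Nondecreasing u × Nondecreasing v
  Nondecreasing-++⁻ nd = ++-monotone⁻ (λ i j i≤j _ → nd i j i≤j) (λ i j i≤j _ → nd i j i≤j)

factorises-++⁻ : ∀ {t} (fL : Vec (Fin s) p) (fR : Vec (Fin s) q) (σL : Vec (Fin t) p) (σR : Vec (Fin t) q) (δ : Vec (Fin s) t) →
  (∀ j → lookup (fL Vec.++ fR) j ≡ lookup δ (lookup (σL Vec.++ σR) j)) →
  (∀ i → lookup fL i ≡ lookup δ (lookup σL i)) × (∀ j → lookup fR j ≡ lookup δ (lookup σR j))
factorises-++⁻ {q = q} fL fR σL σR δ φ≡δσ =
  (λ i → trans (sym (Vec.lookup-++ˡ fL fR i)) (trans (φ≡δσ (i ↑ˡ q)) (cong (lookup δ) (Vec.lookup-++ˡ σL σR i)))) ,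
  (λ j → trans (sym (Vec.lookup-++ʳ fL fR j)) (trans (φ≡δσ (_ ↑ʳ j)) (cong (lookup δ) (Vec.lookup-++ʳ σL σR j))))

-- r is σ_p in the paper's 1-based indexing.
split-bounds : ∀ {t p′ q′} (σL : Vec (Fin t) (suc p′)) (σR : Vec (Fin t) (suc q′)) → Nondecreasing (σL Vec.++ σR) →
  (∀ i j → toℕ i ≡ p′ → toℕ j ≡ suc p′ → lookup (σL Vec.++ σR) i < lookup (σL Vec.++ σR) j) →
  let r = suc (toℕ (lookup (σL Vec.++ σR) (fromℕ p′ ↑ˡ suc q′))) in
  (∀ i → toℕ (lookup σL i) ℕ.< r) × (∀ j → r ℕ.≤ toℕ (lookup σR j))
split-bounds {p′ = p′} {q′} σL σR nd last<first = σL<r , r≤σR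
  where
  last  = fromℕ p′ ↑ˡ suc q′
  first = suc p′ ↑ʳ zero
  σL<r : ∀ i → toℕ (lookup σL i) ℕ.< _
  σL<r i = s≤s (subst (λ x → toℕ x ℕ.≤ _) (Vec.lookup-++ˡ σL σR i)
                 (nd (i ↑ˡ suc q′) last (↑ˡ-≤ (suc q′) (subst (toℕ i ℕ.≤_) (sym (toℕ-fromℕ p′)) (ℕ.≤-pred (toℕ<n i))))))
  r≤σR : ∀ j → _ ℕ.≤ toℕ (lookup σR j)
  r≤σR j = ℕ.≤-trans (last<first last first (trans (toℕ-↑ˡ (fromℕ p′) (suc q′)) (toℕ-fromℕ p′))
                                            (trans (toℕ-↑ʳ (suc p′) zero) (ℕ.+-identityʳ (suc p′))))
             (subst (λ x → _ ℕ.≤ toℕ x) (Vec.lookup-++ʳ σL σR j) (nd first (suc p′ ↑ʳ j) (↑ʳ-≤ (suc p′) z≤n)))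

↭⇒≈V : ∀ {a c ℓ} {Ω : Set a} (_⊕_ : Ω → Ω → Ω) (K : Field c ℓ) {L M : FormalSum Ω} →
       L ↭ M → QuasiShuffle._≈V_ _⊕_ K L M
↭⇒≈V _⊕_ K L↭M f = eval-↭ L↭M
  where
  open Field K using (_≈_; setoid; +-assoc; +-comm; +-cong; +-congˡ) renaming (_+_ to _+ᴷ_)
  open QuasiShuffle _⊕_ using (eval)
  eval-↭ : ∀ {L M} → L ↭ M → eval K f L ≈ eval K f M
  eval-↭ ↭.refl                       = Field.refl K
  eval-↭ (↭.prep w L↭M)               = +-congˡ (eval-↭ L↭M)
  eval-↭ (↭.swap {xs} {ys} w w′ L↭M) = begin
    f w +ᴷ (f w′ +ᴷ eval K f xs)  ≈⟨ +-assoc _ _ _ ⟨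
    (f w +ᴷ f w′) +ᴷ eval K f xs  ≈⟨ +-cong (+-comm _ _) (eval-↭ L↭M) ⟩
    (f w′ +ᴷ f w) +ᴷ eval K f ys  ≈⟨ +-assoc _ _ _ ⟩
    f w′ +ᴷ (f w +ᴷ eval K f ys)  ∎
    where open import Relation.Binary.Reasoning.Setoid setoid
  eval-↭ (↭.trans L↭M M↭N)            = Field.trans K (eval-↭ L↭M) (eval-↭ M↭N)

lemma4p4 : ∀ {a c ℓ} {Ω : Set a} (_⊕_ : Ω → Ω → Ω)
  → IsCommutativeSemigroup _≡_ _⊕_
  → (K : Field c ℓ)
  → (p q s t : ℕ) → 1 ℕ.≤ p → 1 ℕ.≤ q
  → (ω : Vec Ω (p + q))
  → (φ : Vec (Fin s) (p + q)) → IsWeakQsh p φ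
  → (σ : Vec (Fin t) (p + q)) → Surjective σ → Nondecreasing σ
  → (∀ (i j : Fin (p + q)) → toℕ i ≡ p ∸ 1 → toℕ j ≡ p → lookup σ i < lookup σ j)
  → (δ : Vec (Fin s) t)
  → (∀ (i : Fin (p + q)) → toℕ i ≡ p ∸ 1 → IsQsh (suc (toℕ (lookup σ i))) δ)
  → (∀ (j : Fin (p + q)) → lookup φ j ≡ lookup δ (lookup σ j))
  → (E : List (QEntry (p + q) s)) → IsEnumeration p φ E
  → QuasiShuffle._≈V_ _⊕_ K (Sides.lhs _⊕_ ω E) (Sides.rhs _⊕_ ω σ)
lemma4p4 _⊕_ ⊕-isCommutativeSemigroup K (suc p′) (suc q′) s t (s≤s z≤n) (s≤s z≤n)
         ω φ weakQsh σ _ ndσ σp<σp+1 δ δ-isQsh φ≡δσ E isEnumeration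
  with Vec.splitAt (suc p′) ω | Vec.splitAt (suc p′) φ | Vec.splitAt (suc p′) σ
... | wL , wR , refl | fL , fR , refl | σL , σR , refl
  with IsWeakQsh-++⁻ fL fR weakQsh | Nondecreasing-++⁻ σL σR ndσ
     | factorises-++⁻ fL fR σL σR δ φ≡δσ | split-bounds σL σR ndσ σp<σp+1
...   | ndL , ndR | ndσL , ndσR | fL≡δσL , fR≡δσR | σL<r , r≤σR =
  ↭⇒≈V _⊕_ K (FibreProducts.lhs↭rhs _⊕_ ⊕-isCommutativeSemigroup wL wR fL fR σL σR δ _ ndL ndR ndσL ndσR σL<r r≤σR
                (δ-isQsh (fromℕ p′ ↑ˡ suc q′) (trans (toℕ-↑ˡ (fromℕ p′) (suc q′)) (toℕ-fromℕ p′)))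
                fL≡δσL fR≡δσR E isEnumeration)
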